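{- For a positive integer $m$, let $\mathcal{D}(m)$ be the set of squarefree integers $D\ge2$ such that there is no $\alpha\in\mathcal{O}_K^+$ with $p_K(\alpha)=m$, where $K=\mathbb{Q}(\sqrt{D})$. Then \[ \mathcal{D}(1)=\emptyset,\quad \mathcal{D}(2)=\emptyset,\quad \mathcal{D}(3)=\{5\},\quad \mathcal{D}(5)=\{2,3,5\},\quad \mathcal{D}(7)=\{2,5\},\quad \mathcal{D}(11)=\{2,3,5,6,7,13,21\}. \]
   Context: For a real quadratic field $K$, $\mathcal{O}_K$ is its ring of integers and $\mathcal{O}_K^+$ is the set of totally positive elements of $\mathcal{O}_K$ (elements $\gamma$ with $\gamma>0$ and $\gamma'>0$, where $'$ denotes Galois conjugation). A partition of $\alpha\in\mathcal{O}_K^+$ is an expression $\alpha=\alpha_1+\dots+\alpha_k$ with $k\ge1$ and all $\alpha_i\in\mathcal{O}_K^+$, the order of the summands being irrelevant; $p_K(\alpha)$ is the number of partitions of $\alpha$. -}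

module Defs where

open import Data.Nat as ℕ using (ℕ)
open import Data.Integer as ℤ using (ℤ; +_; 0ℤ)
open import Data.Integer.Divisibility as ℤD using ()
open import Data.Nat.Divisibility as ℕD using ()
open import Data.Product using (Σ; _×_; _,_; ∃)
open import Data.List using (List; []; _∷_; length)
open import Data.List.Relation.Unary.All using (All)
open import Data.List.Relation.Unary.Any using (Any)
open import Data.List.Relation.Unary.AllPairs using (AllPairs)
open import Data.List.Relation.Binary.Permutation.Propositional using (_↭_)
open import Relation.Binary.PropositionalEquality using (_≡_)
open import Relation.Nullary using (¬_)

SquareFree : ℕ → Set
SquareFree n = ∀ d → (d ℕ.* d) ℕD.∣ n → d ≡ 1

-- Elements of K = ℚ(√D) whose coordinates lie in ½ℤ are encoded as
-- pairs (u , v) : ℤ × ℤ standing for (u + v√D)/2.  Every algebraic integer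
-- of K has this shape, so this encoding covers 𝒪_K.
Elt : Set
Elt = ℤ × ℤ

_⊕_ : Elt → Elt → Elt
(u , v) ⊕ (u' , v') = (u ℤ.+ u') , (v ℤ.+ v')

zeroE : Elt
zeroE = 0ℤ , 0ℤ

sumE : List Elt → Elt
sumE [] = zeroE
sumE (x ∷ xs) = x ⊕ sumE xs

-- (u + v√D)/2 is an algebraic integer iff its trace u and its norm
-- (u² - D v²)/4 are integers; the trace is automatically integral.
InOK : ℕ → Elt → Set
InOK D (u , v) = (+ 4) ℤD.∣ (u ℤ.* u ℤ.- (+ D) ℤ.* (v ℤ.* v))

-- Totally positive: u + v√D > 0 and u - v√D > 0, i.e. u > |v|√D,
-- equivalently u > 0 and D v² < u².
TotPos : ℕ → Elt → Set
TotPos D (u , v) = InOK D (u , v) × (0ℤ ℤ.< u) × ((+ D) ℤ.* (v ℤ.* v) ℤ.< u ℤ.* u)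

IsPartition : ℕ → Elt → List Elt → Set
IsPartition D α P = (¬ P ≡ []) × All (TotPos D) P × sumE P ≡ α

PartitionCount : ℕ → Elt → ℕ → Set
PartitionCount D α m =
  Σ (List (List Elt)) λ L →
    (length L ≡ m) ×
    All (IsPartition D α) L ×
    AllPairs (λ P Q → ¬ (P ↭ Q)) L ×
    (∀ P → IsPartition D α P → Any (λ Q → P ↭ Q) L)

InDset : ℕ → ℕ → Set
InDset m D = ¬ (Σ Elt λ α → TotPos D α × PartitionCount D α m)

Admissible : ℕ → Set
Admissible D = (2 ℕ.≤ D) × SquareFree D

-- Write p for p_K and α ≽ β for "α = β or α − β is totally positive". Prefixing the
-- summand α − β injects the partitions of β into those of α, so α ≽ β implies
-- p(α) ≥ p(β); multiplying every part by a totally positive unit ε of norm 1 permutes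
-- partitions, so p(εα) = p(α).
--
-- D ∉ 𝒟(m): for D ≥ n² the parts of a partition of the rational integer n are rational
-- integers, so p_K(n) is the classical p(n), and p(1), …, p(6) = 1, 2, 3, 5, 7, 11; for
-- the finitely many smaller admissible D an element with m partitions is enumerated.
--
-- D ∈ 𝒟(m): replacing α by εα or ε⁻¹α as long as this lowers the trace, one may assume
-- α reduced. A reduced α with α ⋡ 7 has bounded trace, and α ≽ 7 is impossible since
-- p(7) > m; so α lies in a finite box, each element of which either lies above some β
-- with p(β) > m or has its partitions enumerated.

{-# OPTIONS --safe #-}
module Submission where

open import Defs
open import Data.Bool using (Bool; true; false; T; _∧_; _∨_; not; if_then_else_)
open import Data.Bool.Properties using (T-∧; T-∨; T-not-≡)
open import Data.Empty using (⊥; ⊥-elim)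
open import Data.Integer as ℤ using (ℤ; +_; -[1+_]; 0ℤ; +≤+; +<+; ∣_∣)
import Data.Integer.Divisibility as ℤD
import Data.Integer.Divisibility.Signed as ℤDS
import Data.Integer.Properties as ℤP
import Data.Integer.Tactic.RingSolver as ℤS
open import Data.List
  using (List; []; _∷_; [_]; _++_; length; map; filter; applyUpTo; upTo; concatMap; cartesianProduct)
open import Data.List.Membership.Propositional using (_∈_)
open import Data.List.Membership.Propositional.Properties
import Data.List.Membership.DecPropositional as DecMembership
open import Data.List.Relation.Binary.Permutation.Propositional
  using (_↭_; ↭-refl; ↭-sym; ↭-trans; prep; swap)
import Data.List.Relation.Binary.Permutation.Propositional as Perm
open import Data.List.Relation.Binary.Permutation.Propositional.Properties
open import Data.List.Relation.Unary.All as All using (All; []; _∷_)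
import Data.List.Relation.Unary.All.Properties as AllP
open import Data.List.Properties using (length-map; length-removeAt′)
open import Data.List.Relation.Unary.AllPairs as AllPairs using (AllPairs; []; _∷_)
import Data.List.Relation.Unary.AllPairs.Properties as AllPairsP
open import Data.List.Relation.Unary.Any as Any using (Any; here; there; any?)
import Data.List.Relation.Unary.Any.Properties as AnyP
open import Data.Nat as ℕ using (ℕ; zero; suc; z≤n; s≤s)
open import Data.Nat.Primality using (euclidsLemma; prime[2])
import Data.Nat.Divisibility as ℕD
import Data.Nat.DivMod as ℕDM
import Data.Nat.Properties as ℕP
import Data.Nat.Tactic.RingSolver as ℕS
open import Data.Product using (_×_; _,_; ∃; proj₁; proj₂)
open import Data.Product.Properties using (≡-dec)
open import Data.Sum using (_⊎_; inj₁; inj₂)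
open import Data.Unit using (tt)
open import Function.Base using (_∘_)
open import Function.Bundles using (_⇔_; mk⇔; Equivalence)
open import Relation.Binary.PropositionalEquality hiding ([_])
open import Relation.Nullary using (¬_; Dec; yes; no; isYes)
open import Relation.Nullary.Decidable using (True; _×-dec_; _⊎-dec_; ¬?; T?; toWitness)

_⊖_ : Elt → Elt → Elt
(u , v) ⊖ (u' , v') = u ℤ.- u' , v ℤ.- v'

_≟E_ : (x y : Elt) → Dec (x ≡ y)
_≟E_ = ≡-dec ℤ._≟_ ℤ._≟_

fromℕ : ℕ → Elt
fromℕ n = + (n ℕ.+ n) , 0ℤ

trace : Elt → ℤ
trace = proj₁

⊕-identityʳ : ∀ x → x ⊕ zeroE ≡ x
⊕-identityʳ (a , b) = cong₂ _,_ (ℤP.+-identityʳ a) (ℤP.+-identityʳ b)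

⊕-⊖-cancelˡ : ∀ x y → (x ⊕ y) ⊖ x ≡ y
⊕-⊖-cancelˡ (a , b) (c , d) = cong₂ _,_ (cancel a c) (cancel b d)
  where
  cancel : ∀ a c → (a ℤ.+ c) ℤ.- a ≡ c
  cancel = ℤS.solve-∀

⊕-⊖-inverseˡ : ∀ x y → x ⊕ (y ⊖ x) ≡ y
⊕-⊖-inverseˡ (a , b) (c , d) = cong₂ _,_ (inverse a c) (inverse b d)
  where
  inverse : ∀ a c → a ℤ.+ (c ℤ.- a) ≡ c
  inverse = ℤS.solve-∀

⊖-⊕-inverseʳ : ∀ x y → (x ⊖ y) ⊕ y ≡ x
⊖-⊕-inverseʳ (a , b) (c , d) = cong₂ _,_ (inverse a c) (inverse b d)
  where
  inverse : ∀ a c → (a ℤ.- c) ℤ.+ c ≡ a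
  inverse = ℤS.solve-∀

⊕-left-comm : ∀ x y z → x ⊕ (y ⊕ z) ≡ y ⊕ (x ⊕ z)
⊕-left-comm (a , b) (c , d) (e , f) = cong₂ _,_ (left-comm a c e) (left-comm b d f)
  where
  left-comm : ∀ a c e → a ℤ.+ (c ℤ.+ e) ≡ c ℤ.+ (a ℤ.+ e)
  left-comm = ℤS.solve-∀

sumE-↭ : ∀ {P Q} → P ↭ Q → sumE P ≡ sumE Q
sumE-↭ Perm.refl = refl
sumE-↭ (prep x p) = cong (x ⊕_) (sumE-↭ p)
sumE-↭ {x ∷ y ∷ _} {_ ∷ _ ∷ ys} (swap _ _ p) =
  trans (cong (λ s → x ⊕ (y ⊕ s)) (sumE-↭ p)) (⊕-left-comm x y (sumE ys))
sumE-↭ (Perm.trans p q) = trans (sumE-↭ p) (sumE-↭ q)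

-- Total positivity

Positive : ℕ → Elt → Set
Positive D (u , v) = (0ℤ ℤ.< u) × ((+ D) ℤ.* (v ℤ.* v) ℤ.< u ℤ.* u)

PositiveOrZero : ℕ → Elt → Set
PositiveOrZero D x = (x ≡ zeroE) ⊎ Positive D x

TotPos⇒Positive : ∀ {D x} → TotPos D x → Positive D x
TotPos⇒Positive (_ , u>0 , Dv²<u²) = u>0 , Dv²<u²

positive? : ∀ D x → Dec (Positive D x)
positive? D (u , v) = (0ℤ ℤ.<? u) ×-dec ((+ D) ℤ.* (v ℤ.* v) ℤ.<? u ℤ.* u)

positiveOrZero? : ∀ D x → Dec (PositiveOrZero D x)
positiveOrZero? D x = (x ≟E zeroE) ⊎-dec positive? D x

totPos? : ∀ D x → Dec (TotPos D x)
totPos? D (u , v) = (4 ℕD.∣? ∣ u ℤ.* u ℤ.- (+ D) ℤ.* (v ℤ.* v) ∣) ×-dec positive? D (u , v)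

i*i≡+∣i∣*∣i∣ : ∀ i → i ℤ.* i ≡ + (∣ i ∣ ℕ.* ∣ i ∣)
i*i≡+∣i∣*∣i∣ (+ n) = sym (ℤP.pos-* n n)
i*i≡+∣i∣*∣i∣ -[1+ n ] = refl

+D*v*v : ∀ D v → + D ℤ.* (v ℤ.* v) ≡ + (D ℕ.* (∣ v ∣ ℕ.* ∣ v ∣))
+D*v*v D v = trans (cong (+ D ℤ.*_) (i*i≡+∣i∣*∣i∣ v)) (sym (ℤP.pos-* D _))

m*m<n*n⇒m<n : ∀ {m n} → m ℕ.* m ℕ.< n ℕ.* n → m ℕ.< n
m*m<n*n⇒m<n {m} {n} m²<n² with n ℕ.≤? m
... | yes n≤m = ⊥-elim (ℕP.<⇒≱ m²<n² (ℕP.*-mono-≤ n≤m n≤m))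
... | no n≰m = ℕP.≰⇒> n≰m

m*m≤n*n⇒m≤n : ∀ {m n} → m ℕ.* m ℕ.≤ n ℕ.* n → m ℕ.≤ n
m*m≤n*n⇒m≤n {m} {n} m²≤n² with m ℕ.≤? n
... | yes m≤n = m≤n
... | no m≰n = let n<m = ℕP.≰⇒> m≰n in ⊥-elim (ℕP.<⇒≱ (ℕP.*-mono-< n<m n<m) m²≤n²)

record PositiveView (D : ℕ) (x : Elt) : Set where
  constructor positiveView
  field
    a : ℕ
    u≡a : proj₁ x ≡ + a
    a>0 : 0 ℕ.< a
    Dv²<a² : D ℕ.* (∣ proj₂ x ∣ ℕ.* ∣ proj₂ x ∣) ℕ.< a ℕ.* a

positive⇒view : ∀ D x → Positive D x → PositiveView D x
positive⇒view D (+ a , v) (+<+ a>0 , Dv²<a²) =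
  positiveView a refl a>0 (ℤP.drop‿+<+ (subst₂ ℤ._<_ (+D*v*v D v) (sym (ℤP.pos-* a a)) Dv²<a²))

view⇒positive : ∀ D x → PositiveView D x → Positive D x
view⇒positive D (u , v) (positiveView a refl a>0 Dv²<a²) =
  +<+ a>0 , subst₂ ℤ._<_ (sym (+D*v*v D v)) (ℤP.pos-* a a) (+<+ Dv²<a²)

-- The cone u > |v|√D is convex: multiplying the two hypotheses gives
-- a₁a₂ ≥ D b₁b₂, so the cross terms of the squares compare as well.
cone-+ : ∀ D a₁ b₁ a₂ b₂ b → D ℕ.* (b₁ ℕ.* b₁) ℕ.< a₁ ℕ.* a₁ → D ℕ.* (b₂ ℕ.* b₂) ℕ.< a₂ ℕ.* a₂ →
         b ℕ.≤ b₁ ℕ.+ b₂ → D ℕ.* (b ℕ.* b) ℕ.< (a₁ ℕ.+ a₂) ℕ.* (a₁ ℕ.+ a₂)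
cone-+ D a₁ b₁ a₂ b₂ b h₁ h₂ b≤ = ℕP.≤-<-trans mono-b (subst₂ ℕ._<_ (sym (D-square D b₁ b₂)) (sym (square a₁ a₂))
  (ℕP.+-mono-<-≤ (ℕP.+-mono-<-≤ h₁ (ℕP.*-monoʳ-≤ 2 cross)) (ℕP.<⇒≤ h₂)))
  where
  D-square : ∀ D x y → D ℕ.* ((x ℕ.+ y) ℕ.* (x ℕ.+ y)) ≡ D ℕ.* (x ℕ.* x) ℕ.+ 2 ℕ.* (D ℕ.* x ℕ.* y) ℕ.+ D ℕ.* (y ℕ.* y)
  D-square = ℕS.solve-∀
  square : ∀ x y → (x ℕ.+ y) ℕ.* (x ℕ.+ y) ≡ x ℕ.* x ℕ.+ 2 ℕ.* (x ℕ.* y) ℕ.+ y ℕ.* y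
  square = ℕS.solve-∀
  cross-sq : ∀ D x y → (D ℕ.* x ℕ.* y) ℕ.* (D ℕ.* x ℕ.* y) ≡ (D ℕ.* (x ℕ.* x)) ℕ.* (D ℕ.* (y ℕ.* y))
  cross-sq = ℕS.solve-∀
  prod-sq : ∀ x y → (x ℕ.* x) ℕ.* (y ℕ.* y) ≡ (x ℕ.* y) ℕ.* (x ℕ.* y)
  prod-sq = ℕS.solve-∀
  cross : D ℕ.* b₁ ℕ.* b₂ ℕ.≤ a₁ ℕ.* a₂
  cross = m*m≤n*n⇒m≤n (subst₂ ℕ._≤_ (sym (cross-sq D b₁ b₂)) (prod-sq a₁ a₂) (ℕP.*-mono-≤ (ℕP.<⇒≤ h₁) (ℕP.<⇒≤ h₂)))
  mono-b : D ℕ.* (b ℕ.* b) ℕ.≤ D ℕ.* ((b₁ ℕ.+ b₂) ℕ.* (b₁ ℕ.+ b₂))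
  mono-b = ℕP.*-monoʳ-≤ D (ℕP.*-mono-≤ b≤ b≤)

positive-⊕ : ∀ D x y → Positive D x → Positive D y → Positive D (x ⊕ y)
positive-⊕ D x y px py with positive⇒view D x px | positive⇒view D y py
positive-⊕ D (_ , v₁) (_ , v₂) _ _ | positiveView a₁ refl a₁>0 h₁ | positiveView a₂ refl _ h₂ =
  view⇒positive D (+ a₁ ℤ.+ + a₂ , v₁ ℤ.+ v₂) (positiveView (a₁ ℕ.+ a₂) refl (ℕP.<-≤-trans a₁>0 (ℕP.m≤m+n a₁ a₂))
    (cone-+ D a₁ (∣ v₁ ∣) a₂ (∣ v₂ ∣) _ h₁ h₂ (ℤP.∣i+j∣≤∣i∣+∣j∣ v₁ v₂)))

sumE-positiveOrZero : ∀ D P → All (TotPos D) P → PositiveOrZero D (sumE P)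
sumE-positiveOrZero D [] [] = inj₁ refl
sumE-positiveOrZero D (x ∷ P) (t ∷ ts) with sumE-positiveOrZero D P ts
... | inj₁ ΣP≡0 = inj₂ (subst (Positive D) (sym (trans (cong (x ⊕_) ΣP≡0) (⊕-identityʳ x))) (TotPos⇒Positive {D} {x} t))
... | inj₂ ΣP≻0 = inj₂ (positive-⊕ D x (sumE P) (TotPos⇒Positive {D} {x} t) ΣP≻0)

-- Counting partitions

Distinct : List (List Elt) → Set
Distinct = AllPairs (λ P Q → ¬ (P ↭ Q))

_∈↭_ : List Elt → List (List Elt) → Set
P ∈↭ C = Any (P ↭_) C

∈↭-─ : ∀ {P R} C (P∈C : P ∈↭ C) → R ∈↭ C → ¬ (P ↭ R) → R ∈↭ (C Any.─ P∈C)
∈↭-─ (_ ∷ _) (here P↭c) (here R↭c) P≁R = ⊥-elim (P≁R (↭-trans P↭c (↭-sym R↭c)))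
∈↭-─ (_ ∷ _) (here _) (there R∈C) _ = R∈C
∈↭-─ (_ ∷ _) (there _) (here R↭c) _ = here R↭c
∈↭-─ (_ ∷ C) (there P∈C) (there R∈C) P≁R = there (∈↭-─ C P∈C R∈C P≁R)

distinct-length-≤ : ∀ L C → Distinct L → All (_∈↭ C) L → length L ℕ.≤ length C
distinct-length-≤ [] C _ _ = z≤n
distinct-length-≤ (P ∷ L) C (P≁L ∷ L-distinct) (P∈C ∷ L⊆C) =
  subst (suc (length L) ℕ.≤_) (sym (length-removeAt′ C (Any.index P∈C)))
    (s≤s (distinct-length-≤ L (C Any.─ P∈C) L-distinct
      (All.zipWith (λ (P≁R , R∈C) → ∈↭-─ C P∈C R∈C P≁R) (P≁L , L⊆C))))

partitions-length-≤ : ∀ {D α m} L → All (IsPartition D α) L → Distinct L → PartitionCount D α m → length L ℕ.≤ m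
partitions-length-≤ L L-partitions L-distinct (C , |C|≡m , _ , _ , complete) =
  subst (length L ℕ.≤_) |C|≡m (distinct-length-≤ L C L-distinct (All.map (complete _) L-partitions))

partitionCount-unique : ∀ {D α m k} → PartitionCount D α m → PartitionCount D α k → m ≡ k
partitionCount-unique {D} {α} pm pk = ℕP.≤-antisym (count-≤ pm pk) (count-≤ pk pm)
  where
  count-≤ : ∀ {m k} → PartitionCount D α m → PartitionCount D α k → m ℕ.≤ k
  count-≤ (L , refl , L-partitions , L-distinct , _) = partitions-length-≤ {D} {α} L L-partitions L-distinct

_≽[_]_ : Elt → ℕ → Elt → Set
α ≽[ D ] β = (α ≡ β) ⊎ TotPos D (α ⊖ β)

_≽?[_]_ : ∀ α D β → Dec (α ≽[ D ] β)
α ≽?[ D ] β = (α ≟E β) ⊎-dec totPos? D (α ⊖ β)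

partitionCount-mono : ∀ {D α β m k} → α ≽[ D ] β → PartitionCount D β k → PartitionCount D α m → k ℕ.≤ m
partitionCount-mono {D} {α} (inj₁ refl) pk pm = ℕP.≤-reflexive (partitionCount-unique {D} {α} pk pm)
partitionCount-mono {D} {α} {β} (inj₂ γ≻0) (L , refl , L-partitions , L-distinct , _) pm =
  subst (ℕ._≤ _) (length-map (γ ∷_) L) (partitions-length-≤ {D} {α} (map (γ ∷_) L) γL-partitions γL-distinct pm)
  where
  γ = α ⊖ β
  γL-partitions : All (IsPartition D α) (map (γ ∷_) L)
  γL-partitions = AllP.map⁺ (All.map (λ { (_ , P≻0 , ΣP≡β) →
    (λ ()) , γ≻0 ∷ P≻0 , trans (cong (γ ⊕_) ΣP≡β) (⊖-⊕-inverseʳ α β) }) L-partitions)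
  γL-distinct : Distinct (map (γ ∷_) L)
  γL-distinct = AllPairsP.map⁺ (AllPairs.map (λ P≁Q γP↭γQ → P≁Q (drop-∷ γP↭γQ)) L-distinct)

-- Enumerating partitions

length≤trace : ∀ D P → All (TotPos D) P → + length P ℤ.≤ trace (sumE P)
length≤trace D [] [] = +≤+ z≤n
length≤trace D (x ∷ P) ((_ , +<+ (s≤s _) , _) ∷ P≻0) = ℤP.+-mono-≤ (+≤+ (s≤s z≤n)) (length≤trace D P P≻0)

partition-length≤trace : ∀ {D α} P → IsPartition D α P → length P ℕ.≤ ∣ trace α ∣
partition-length≤trace {D} P (_ , P≻0 , refl) with trace (sumE P) | length≤trace D P P≻0
... | _ | +≤+ l≤t = l≤t

keepIf : ∀ {A : Set} → Dec A → List (List Elt) → List (List Elt)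
keepIf (yes _) L = L
keepIf (no _) _ = []

keepIf-yes : ∀ {A : Set} (d : Dec A) → A → ∀ L → keepIf d L ≡ L
keepIf-yes (yes _) _ L = refl
keepIf-yes (no ¬a) a L = ⊥-elim (¬a a)

keepIf-sound : ∀ {A : Set} (d : Dec A) L {Q} → Q ∈ keepIf d L → A × Q ∈ L
keepIf-sound (yes a) L Q∈L = a , Q∈L

-- Lists of at most n elements of C, in the order of C, summing to t; a branch
-- is cut as soon as the remainder is not ≽ 0.
multisets : ℕ → ℕ → List Elt → Elt → List (List Elt)
multisets D zero C t = keepIf (t ≟E zeroE) [ [] ]
multisets D (suc n) [] t = keepIf (t ≟E zeroE) [ [] ]
multisets D (suc n) (x ∷ C) t =
  multisets D (suc n) C t ++ keepIf (positiveOrZero? D (t ⊖ x)) (map (x ∷_) (multisets D n (x ∷ C) (t ⊖ x)))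

data OrderedBy : List Elt → List Elt → Set where
  none : ∀ {C} → OrderedBy C []
  take : ∀ {x C Q} → OrderedBy (x ∷ C) Q → OrderedBy (x ∷ C) (x ∷ Q)
  skip : ∀ {x C Q} → OrderedBy C Q → OrderedBy (x ∷ C) Q

orderedBy-insert : ∀ {y C Q} → y ∈ C → OrderedBy C Q → ∃ λ Q′ → (y ∷ Q ↭ Q′) × OrderedBy C Q′
orderedBy-insert {y} {x ∷ C} {Q} (here refl) o = x ∷ Q , ↭-refl , take o
orderedBy-insert (there y∈C) none with orderedBy-insert y∈C none
... | Q′ , p , o′ = Q′ , p , skip o′
orderedBy-insert {y} {x ∷ C} (there y∈C) (take o) with orderedBy-insert (there y∈C) o
... | Q′ , p , o′ = x ∷ Q′ , ↭-trans (swap y x ↭-refl) (prep x p) , take o′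
orderedBy-insert (there y∈C) (skip o) with orderedBy-insert y∈C o
... | Q′ , p , o′ = Q′ , p , skip o′

orderedBy-sort : ∀ {C} P → All (_∈ C) P → ∃ λ Q → (P ↭ Q) × OrderedBy C Q
orderedBy-sort [] [] = [] , ↭-refl , none
orderedBy-sort (y ∷ P) (y∈C ∷ P⊆C) with orderedBy-sort P P⊆C
... | Q , p , o with orderedBy-insert y∈C o
... | Q′ , p′ , o′ = Q′ , ↭-trans (prep y p) p′ , o′

[]∈multisets : ∀ D n C → [] ∈ multisets D n C zeroE
[]∈multisets D zero C = here refl
[]∈multisets D (suc n) [] = here refl
[]∈multisets D (suc n) (x ∷ C) = ∈-++⁺ˡ ([]∈multisets D (suc n) C)

multisets-complete : ∀ D n C Q → OrderedBy C Q → All (TotPos D) Q → length Q ℕ.≤ n → Q ∈ multisets D n C (sumE Q)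
multisets-complete D n C [] _ _ _ = []∈multisets D n C
multisets-complete D (suc n) (x ∷ C) (x ∷ Q) (take o) (_ ∷ Q≻0) (s≤s |Q|≤n) =
  ∈-++⁺ʳ (multisets D (suc n) C (x ⊕ sumE Q))
    (subst ((x ∷ Q) ∈_) (sym (keepIf-yes (positiveOrZero? D ((x ⊕ sumE Q) ⊖ x)) rest≽0 _))
      (∈-map⁺ (x ∷_) (subst (λ s → Q ∈ multisets D n (x ∷ C) s) (sym (⊕-⊖-cancelˡ x (sumE Q)))
        (multisets-complete D n (x ∷ C) Q o Q≻0 |Q|≤n))))
  where
  rest≽0 = subst (PositiveOrZero D) (sym (⊕-⊖-cancelˡ x (sumE Q))) (sumE-positiveOrZero D Q Q≻0)
multisets-complete D (suc n) (x ∷ C) (y ∷ Q) (skip o) Q≻0 |Q|≤n =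
  ∈-++⁺ˡ (multisets-complete D (suc n) C (y ∷ Q) o Q≻0 |Q|≤n)

multisets-sound : ∀ D n C t Q → Q ∈ multisets D n C t → All (_∈ C) Q × sumE Q ≡ t
multisets-sound D zero C t Q Q∈ with keepIf-sound (t ≟E zeroE) [ [] ] Q∈
... | refl , here refl = [] , refl
multisets-sound D (suc n) [] t Q Q∈ with keepIf-sound (t ≟E zeroE) [ [] ] Q∈
... | refl , here refl = [] , refl
multisets-sound D (suc n) (x ∷ C) t Q Q∈ with ∈-++⁻ (multisets D (suc n) C t) Q∈
... | inj₁ Q∈skip with multisets-sound D (suc n) C t Q Q∈skip
...   | Q⊆C , ΣQ≡t = All.map there Q⊆C , ΣQ≡t
multisets-sound D (suc n) (x ∷ C) t Q Q∈ | inj₂ Q∈take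
  with ∈-map⁻ (x ∷_) (proj₂ (keepIf-sound (positiveOrZero? D (t ⊖ x)) _ Q∈take))
... | Q′ , Q′∈ , refl with multisets-sound D n (x ∷ C) (t ⊖ x) Q′ Q′∈
...   | Q′⊆C , ΣQ′≡t-x = (here refl ∷ Q′⊆C) , trans (cong (x ⊕_) ΣQ′≡t-x) (⊕-⊖-inverseˡ x t)

count : Elt → List Elt → ℕ
count x P = length (filter (x ≟E_) P)

count-↭ : ∀ x {P Q} → P ↭ Q → count x P ≡ count x Q
count-↭ x P↭Q = ↭-length (filter-↭ (x ≟E_) P↭Q)

differsOn : List Elt → List Elt → List Elt → Bool
differsOn P Q [] = false
differsOn P Q (x ∷ xs) = not (count x P ℕ.≡ᵇ count x Q) ∨ differsOn P Q xs

differsOn-sound : ∀ P Q xs → T (differsOn P Q xs) → ¬ (P ↭ Q)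
differsOn-sound P Q (x ∷ xs) t P↭Q with Equivalence.to T-∨ t
... | inj₁ counts-differ = subst T (Equivalence.to T-not-≡ counts-differ) (ℕP.≡⇒≡ᵇ _ _ (count-↭ x P↭Q))
... | inj₂ t′ = differsOn-sound P Q xs t′ P↭Q

differsFromAll : List Elt → List (List Elt) → Bool
differsFromAll P [] = true
differsFromAll P (Q ∷ L) = differsOn P Q (P ++ Q) ∧ differsFromAll P L

differsFromAll-sound : ∀ P L → T (differsFromAll P L) → All (λ Q → ¬ (P ↭ Q)) L
differsFromAll-sound P [] _ = []
differsFromAll-sound P (Q ∷ L) t with Equivalence.to T-∧ t
... | P≁Q , P≁L = differsOn-sound P Q (P ++ Q) P≁Q ∷ differsFromAll-sound P L P≁L

distinctᵇ : List (List Elt) → Bool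
distinctᵇ [] = true
distinctᵇ (P ∷ L) = differsFromAll P L ∧ distinctᵇ L

distinctᵇ-sound : ∀ L → T (distinctᵇ L) → Distinct L
distinctᵇ-sound [] _ = []
distinctᵇ-sound (P ∷ L) t with Equivalence.to T-∧ t
... | P≁L , L-distinct = differsFromAll-sound P L P≁L ∷ distinctᵇ-sound L L-distinct

-- D′ only steers the pruning of the search: enumerating with D′ = 1 gives a
-- list that serves every D at once.
partitionCount-enumerate : ∀ D D′ α C → All (TotPos D) C → All (TotPos D′) C →
  (∀ P → IsPartition D α P → All (_∈ C) P) → TotPos D α →
  T (distinctᵇ (multisets D′ ∣ trace α ∣ C α)) → PartitionCount D α (length (multisets D′ ∣ trace α ∣ C α))
partitionCount-enumerate D D′ α C C≻0 C≻′0 parts∈C α≻0 t = L , refl , L-partitions , distinctᵇ-sound L t , complete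
  where
  L = multisets D′ ∣ trace α ∣ C α
  L-partitions : All (IsPartition D α) L
  L-partitions = All.tabulate λ {Q} Q∈L → let (Q⊆C , ΣQ≡α) = multisets-sound D′ ∣ trace α ∣ C α Q Q∈L in
    (λ { refl → ℤP.<-irrefl refl (subst (λ z → 0ℤ ℤ.< trace z) (sym ΣQ≡α) (proj₁ (proj₂ α≻0))) }) ,
    All.map (All.lookup C≻0) Q⊆C , ΣQ≡α
  complete : ∀ P → IsPartition D α P → P ∈↭ L
  complete P P-partition@(_ , P≻0 , ΣP≡α) with orderedBy-sort P (parts∈C P P-partition)
  ... | Q , P↭Q , Q-ordered = Any.map (λ { refl → P↭Q }) Q∈L
    where
    Q≻′0 = All.map (All.lookup C≻′0) (All-resp-↭ P↭Q (parts∈C P P-partition))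
    |Q|≤ : length Q ℕ.≤ ∣ trace α ∣
    |Q|≤ = subst (ℕ._≤ ∣ trace α ∣) (↭-length P↭Q) (partition-length≤trace {D} P P-partition)
    Q∈L : Q ∈ L
    Q∈L = subst (λ s → Q ∈ multisets D′ ∣ trace α ∣ C s) (trans (sym (sumE-↭ P↭Q)) ΣP≡α)
      (multisets-complete D′ _ C Q Q-ordered Q≻′0 |Q|≤)

+m≤i⇒m≤∣i∣ : ∀ {m i} → + m ℤ.≤ i → m ℕ.≤ ∣ i ∣
+m≤i⇒m≤∣i∣ (+≤+ m≤n) = m≤n

positiveOrZero⇒0≤trace : ∀ {D} t → PositiveOrZero D t → 0ℤ ℤ.≤ trace t
positiveOrZero⇒0≤trace t (inj₁ refl) = +≤+ z≤n
positiveOrZero⇒0≤trace t (inj₂ (0<u , _)) = ℤP.<⇒≤ 0<u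

traceRange : ℕ → List ℤ
traceRange n = applyUpTo (λ i → + suc i) n

±suc : ℕ → List ℤ
±suc k = + suc k ∷ -[1+ k ] ∷ []

coefficientRange : ℕ → List ℤ
coefficientRange n = + 0 ∷ concatMap ±suc (upTo n)

box : ℕ → List Elt
box n = cartesianProduct (traceRange n) (coefficientRange n)

∈-traceRange : ∀ {n a} → 0 ℕ.< a → a ℕ.≤ n → + a ∈ traceRange n
∈-traceRange {a = suc k} _ k<n = ∈-applyUpTo⁺ (λ i → + suc i) k<n

∈-coefficientRange : ∀ {n} v → ∣ v ∣ ℕ.≤ n → v ∈ coefficientRange n
∈-coefficientRange (+ zero) _ = here refl
∈-coefficientRange (+ suc k) k<n =
  there (∈-concatMap⁺ ±suc (Any.map (λ { refl → here refl }) (∈-upTo⁺ k<n)))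
∈-coefficientRange -[1+ k ] k<n =
  there (∈-concatMap⁺ ±suc (Any.map (λ { refl → there (here refl) }) (∈-upTo⁺ k<n)))

-- For D ≥ 1 total positivity forces |v| < u, so the trace bounds both coordinates.
positive-∈-box : ∀ {D n} x → 1 ℕ.≤ D → Positive D x → ∣ trace x ∣ ℕ.≤ n → x ∈ box n
positive-∈-box {D} x D≥1 x≻0 u≤n with positive⇒view D x x≻0
positive-∈-box {D} (_ , v) D≥1 _ u≤n | positiveView a refl a>0 Dv²<a² =
  ∈-cartesianProduct⁺ (∈-traceRange a>0 u≤n) (∈-coefficientRange v (ℕP.≤-trans (ℕP.<⇒≤ v<a) u≤n))
  where
  v<a : ∣ v ∣ ℕ.< a
  v<a = m*m<n*n⇒m<n (ℕP.≤-<-trans v²≤Dv² Dv²<a²)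
    where
    v²≤Dv² : ∣ v ∣ ℕ.* ∣ v ∣ ℕ.≤ D ℕ.* (∣ v ∣ ℕ.* ∣ v ∣)
    v²≤Dv² = subst (ℕ._≤ D ℕ.* (∣ v ∣ ℕ.* ∣ v ∣)) (ℕP.*-identityˡ _) (ℕP.*-monoˡ-≤ (∣ v ∣ ℕ.* ∣ v ∣) D≥1)

Summand : ℕ → Elt → Elt → Set
Summand D α x = TotPos D x × PositiveOrZero D (α ⊖ x)

summand? : ∀ D α x → Dec (Summand D α x)
summand? D α x = totPos? D x ×-dec positiveOrZero? D (α ⊖ x)

candidates : ℕ → Elt → List Elt
candidates D α = filter (summand? D α) (box ∣ trace α ∣)

summand-trace≤ : ∀ {D} α x → Summand D α x → ∣ trace x ∣ ℕ.≤ ∣ trace α ∣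
summand-trace≤ {D} α x (x≻0 , rest≽0) = +m≤i⇒m≤∣i∣ (subst (_ ℤ.≤_) (cong trace (⊕-⊖-inverseˡ x α)) u≤)
  where
  u≤ : + ∣ trace x ∣ ℤ.≤ trace x ℤ.+ trace (α ⊖ x)
  u≤ = ℤP.≤-trans (ℤP.≤-reflexive (ℤP.0≤i⇒+∣i∣≡i (ℤP.<⇒≤ (proj₁ (proj₂ x≻0)))))
         (subst (ℤ._≤ trace x ℤ.+ trace (α ⊖ x)) (ℤP.+-identityʳ (trace x))
           (ℤP.+-monoʳ-≤ (trace x) (positiveOrZero⇒0≤trace {D} (α ⊖ x) rest≽0)))

part⇒summand : ∀ {D α P x} → IsPartition D α P → x ∈ P → Summand D α x
part⇒summand {D} {α} {P} {x} (_ , P≻0 , ΣP≡α) x∈P with ∈-∃++ x∈P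
... | ys , zs , refl = All.head x∷rest≻0 , subst (PositiveOrZero D) (sym rest≡) (sumE-positiveOrZero D (ys ++ zs) (All.tail x∷rest≻0))
  where
  x∷rest≻0 : All (TotPos D) (x ∷ ys ++ zs)
  x∷rest≻0 = All-resp-↭ (shift x ys zs) P≻0
  rest≡ : α ⊖ x ≡ sumE (ys ++ zs)
  rest≡ = trans (cong (_⊖ x) (trans (sym ΣP≡α) (sumE-↭ (shift x ys zs)))) (⊕-⊖-cancelˡ x (sumE (ys ++ zs)))

parts∈candidates : ∀ {D} α → 1 ℕ.≤ D → ∀ P → IsPartition D α P → All (_∈ candidates D α) P
parts∈candidates {D} α D≥1 P P-partition = All.tabulate λ {x} x∈P →
  let x-summand = part⇒summand {D} {α} P-partition x∈P in
  ∈-filter⁺ (summand? D α)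
    (positive-∈-box x D≥1 (TotPos⇒Positive {D} {x} (proj₁ x-summand)) (summand-trace≤ {D} α x x-summand)) x-summand

partitionsOf : ℕ → Elt → List (List Elt)
partitionsOf D α = multisets D ∣ trace α ∣ (candidates D α) α

partitionCount-partitionsOf : ∀ D α → 1 ℕ.≤ D → TotPos D α → T (distinctᵇ (partitionsOf D α)) →
  PartitionCount D α (length (partitionsOf D α))
partitionCount-partitionsOf D α D≥1 =
  partitionCount-enumerate D D α (candidates D α) C≻0 C≻0 (parts∈candidates α D≥1)
  where
  C≻0 = All.map proj₁ (AllP.all-filter (summand? D α) (box ∣ trace α ∣))

-- Multiplication by units

record PartitionSymmetry (D : ℕ) : Set where
  field
    f g : Elt → Elt
    f-totPos : ∀ x → TotPos D x → TotPos D (f x)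
    g-totPos : ∀ x → TotPos D x → TotPos D (g x)
    g∘f : ∀ x → TotPos D x → g (f x) ≡ x
    f∘g : ∀ x → TotPos D x → f (g x) ≡ x
    f-sumE : ∀ P → All (TotPos D) P → f (sumE P) ≡ sumE (map f P)
    g-sumE : ∀ P → All (TotPos D) P → g (sumE P) ≡ sumE (map g P)

  inverse : PartitionSymmetry D
  inverse = record
    { f = g ; g = f ; f-totPos = g-totPos ; g-totPos = f-totPos
    ; g∘f = f∘g ; f∘g = g∘f ; f-sumE = g-sumE ; g-sumE = f-sumE }

  private
    map-g∘f : ∀ P → All (TotPos D) P → map g (map f P) ≡ P
    map-g∘f [] [] = refl
    map-g∘f (x ∷ P) (x≻0 ∷ P≻0) = cong₂ _∷_ (g∘f x x≻0) (map-g∘f P P≻0)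

    map-f∘g : ∀ P → All (TotPos D) P → map f (map g P) ≡ P
    map-f∘g [] [] = refl
    map-f∘g (x ∷ P) (x≻0 ∷ P≻0) = cong₂ _∷_ (f∘g x x≻0) (map-f∘g P P≻0)

    map-≢[] : ∀ (h : Elt → Elt) P → ¬ P ≡ [] → ¬ map h P ≡ []
    map-≢[] h [] P≢[] _ = P≢[] refl

    map-partition : ∀ {α} P → IsPartition D α P → IsPartition D (f α) (map f P)
    map-partition P (P≢[] , P≻0 , ΣP≡α) =
      map-≢[] f P P≢[] , AllP.map⁺ (All.map (f-totPos _) P≻0) , trans (sym (f-sumE P P≻0)) (cong f ΣP≡α)

    map-f-reflects-↭ : ∀ {P Q} → All (TotPos D) P → All (TotPos D) Q → map f P ↭ map f Q → P ↭ Q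
    map-f-reflects-↭ {P} {Q} P≻0 Q≻0 fP↭fQ = subst₂ _↭_ (map-g∘f P P≻0) (map-g∘f Q Q≻0) (map⁺ g fP↭fQ)

    map-distinct : ∀ {α} L → All (IsPartition D α) L → Distinct L → Distinct (map (map f) L)
    map-distinct [] [] [] = []
    map-distinct {α} (P ∷ L) ((_ , P≻0 , _) ∷ L-partitions) (P≁L ∷ L-distinct) =
      head-distinct L L-partitions P≁L ∷ map-distinct L L-partitions L-distinct
      where
      head-distinct : ∀ L → All (IsPartition D α) L → All (λ Q → ¬ (P ↭ Q)) L → All (λ Q → ¬ (map f P ↭ Q)) (map (map f) L)
      head-distinct [] [] [] = []
      head-distinct (Q ∷ L) ((_ , Q≻0 , _) ∷ L-partitions) (P≁Q ∷ P≁L) =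
        (λ fP↭fQ → P≁Q (map-f-reflects-↭ P≻0 Q≻0 fP↭fQ)) ∷ head-distinct L L-partitions P≁L

  partitionCount-symmetry : ∀ {α m} → TotPos D α → PartitionCount D α m → PartitionCount D (f α) m
  partitionCount-symmetry {α} α≻0 (L , |L|≡m , L-partitions , L-distinct , complete) =
    map (map f) L , trans (length-map _ L) |L|≡m , fL-partitions , fL-distinct , fL-complete
    where
    fL-partitions : All (IsPartition D (f α)) (map (map f) L)
    fL-partitions = AllP.map⁺ (All.map (map-partition _) L-partitions)
    fL-distinct : Distinct (map (map f) L)
    fL-distinct = map-distinct L L-partitions L-distinct
    fL-complete : ∀ P → IsPartition D (f α) P → P ∈↭ map (map f) L
    fL-complete P (P≢[] , P≻0 , ΣP≡fα) = AnyP.map⁺ (Any.map (λ {Q} gP↭Q → subst (_↭ map f Q) (map-f∘g P P≻0) (map⁺ f gP↭Q))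
      (complete (map g P) (map-≢[] g P P≢[] , AllP.map⁺ (All.map (g-totPos _) P≻0) ,
        trans (sym (g-sumE P P≻0)) (trans (cong g ΣP≡fα) (g∘f α α≻0)))))

-- Four times the field norm of (u + v√D)/2; InOK says that 4 divides it.
norm : ℕ → Elt → ℤ
norm D (u , v) = u ℤ.* u ℤ.- + D ℤ.* (v ℤ.* v)

positive⇒0<norm : ∀ D x → Positive D x → 0ℤ ℤ.< norm D x
positive⇒0<norm D (u , v) (_ , Dv²<u²) =
  subst (ℤ._< norm D (u , v)) (ℤP.+-inverseʳ (+ D ℤ.* (v ℤ.* v))) (ℤP.+-monoˡ-< (ℤ.- (+ D ℤ.* (v ℤ.* v))) Dv²<u²)

0<norm⇒Dv²<u² : ∀ D x → 0ℤ ℤ.< norm D x → + D ℤ.* (proj₂ x ℤ.* proj₂ x) ℤ.< proj₁ x ℤ.* proj₁ x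
0<norm⇒Dv²<u² D (u , v) 0<N =
  subst₂ ℤ._<_ (ℤP.+-identityˡ _) (sym (split (u ℤ.* u) (+ D ℤ.* (v ℤ.* v)))) (ℤP.+-monoˡ-< (+ D ℤ.* (v ℤ.* v)) 0<N)
  where
  split : ∀ x y → x ≡ (x ℤ.- y) ℤ.+ y
  split = ℤS.solve-∀

norm≡4⇒ℕ : ∀ D A b → norm D (+ A , b) ≡ + 4 → A ℕ.* A ≡ D ℕ.* (∣ b ∣ ℕ.* ∣ b ∣) ℕ.+ 4
norm≡4⇒ℕ D A b N≡4 = ℤP.+-injective (begin
  + (A ℕ.* A)                            ≡⟨ ℤP.pos-* A A ⟩
  + A ℤ.* + A                            ≡⟨ split (+ A ℤ.* + A) (+ D ℤ.* (b ℤ.* b)) ⟩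
  norm D (+ A , b) ℤ.+ + D ℤ.* (b ℤ.* b) ≡⟨ cong₂ ℤ._+_ N≡4 (+D*v*v D b) ⟩
  + 4 ℤ.+ + (D ℕ.* (∣ b ∣ ℕ.* ∣ b ∣))    ≡⟨ ℤP.+-comm (+ 4) (+ (D ℕ.* (∣ b ∣ ℕ.* ∣ b ∣))) ⟩
  + (D ℕ.* (∣ b ∣ ℕ.* ∣ b ∣) ℕ.+ 4)      ∎)
  where
  open ≡-Reasoning
  split : ∀ x y → x ≡ (x ℤ.- y) ℤ.+ y
  split = ℤS.solve-∀

half : ℤ → ℤ
half (+ n) = + (n ℕ./ 2)
half -[1+ n ] = ℤ.- (+ (suc n ℕ./ 2))

half-double : ∀ k → half (k ℤ.+ k) ≡ k
half-double (+ m) = cong +_ (trans (cong (ℕ._/ 2) (double m)) (ℕDM.m*n/n≡m m 2))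
  where
  double : ∀ m → m ℕ.+ m ≡ m ℕ.* 2
  double = ℕS.solve-∀
half-double -[1+ m ] = cong (λ z → ℤ.- (+ z)) (trans (cong (ℕ._/ 2) (double m)) (ℕDM.m*n/n≡m (suc m) 2))
  where
  double : ∀ m → suc (suc (m ℕ.+ m)) ≡ suc m ℕ.* 2
  double = ℕS.solve-∀

0<k+k⇒0<k : ∀ k → 0ℤ ℤ.< k ℤ.+ k → 0ℤ ℤ.< k
0<k+k⇒0<k (+ suc m) _ = +<+ (s≤s z≤n)
0<k+k⇒0<k (+ zero) (+<+ ())
0<k+k⇒0<k -[1+ m ] ()

module _ (D : ℕ) where
  private
    d = + D

  -- Multiplication by ε = (a + b√D)/2: ε(u + v√D)/2 = ((au + Dbv)/2 + (bu + av)/2 √D)/2.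
  mul : ℤ → ℤ → Elt → Elt
  mul a b (u , v) = half (a ℤ.* u ℤ.+ d ℤ.* (b ℤ.* v)) , half (b ℤ.* u ℤ.+ a ℤ.* v)

  EvenProduct : ℤ → ℤ → Elt → Set
  EvenProduct a b (u , v) = (∃ λ k₁ → a ℤ.* u ℤ.+ d ℤ.* (b ℤ.* v) ≡ k₁ ℤ.+ k₁) × (∃ λ k₂ → b ℤ.* u ℤ.+ a ℤ.* v ≡ k₂ ℤ.+ k₂)

  mul-even : ∀ a b x (e : EvenProduct a b x) → mul a b x ≡ (proj₁ (proj₁ e) , proj₁ (proj₂ e))
  mul-even a b (u , v) ((k₁ , e₁) , (k₂ , e₂)) =
    cong₂ _,_ (trans (cong half e₁) (half-double k₁)) (trans (cong half e₂) (half-double k₂))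

  evenProduct-zero : ∀ a b → EvenProduct a b zeroE
  evenProduct-zero a b = (0ℤ , first a d b) , (0ℤ , second a b)
    where
    first : ∀ a d b → a ℤ.* 0ℤ ℤ.+ d ℤ.* (b ℤ.* 0ℤ) ≡ 0ℤ ℤ.+ 0ℤ
    first = ℤS.solve-∀
    second : ∀ a b → b ℤ.* 0ℤ ℤ.+ a ℤ.* 0ℤ ≡ 0ℤ ℤ.+ 0ℤ
    second = ℤS.solve-∀

  evenProduct-⊕ : ∀ a b x y → EvenProduct a b x → EvenProduct a b y → EvenProduct a b (x ⊕ y)
  evenProduct-⊕ a b (u₁ , v₁) (u₂ , v₂) ((k₁ , e₁) , (k₂ , e₂)) ((l₁ , f₁) , (l₂ , f₂)) =
    (k₁ ℤ.+ l₁ , trans (first a d b u₁ u₂ v₁ v₂) (trans (cong₂ ℤ._+_ e₁ f₁) (interchange k₁ l₁))) ,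
    (k₂ ℤ.+ l₂ , trans (second a b u₁ u₂ v₁ v₂) (trans (cong₂ ℤ._+_ e₂ f₂) (interchange k₂ l₂)))
    where
    first : ∀ a d b u₁ u₂ v₁ v₂ → a ℤ.* (u₁ ℤ.+ u₂) ℤ.+ d ℤ.* (b ℤ.* (v₁ ℤ.+ v₂)) ≡
                                 (a ℤ.* u₁ ℤ.+ d ℤ.* (b ℤ.* v₁)) ℤ.+ (a ℤ.* u₂ ℤ.+ d ℤ.* (b ℤ.* v₂))
    first = ℤS.solve-∀
    second : ∀ a b u₁ u₂ v₁ v₂ → b ℤ.* (u₁ ℤ.+ u₂) ℤ.+ a ℤ.* (v₁ ℤ.+ v₂) ≡ (b ℤ.* u₁ ℤ.+ a ℤ.* v₁) ℤ.+ (b ℤ.* u₂ ℤ.+ a ℤ.* v₂)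
    second = ℤS.solve-∀
    interchange : ∀ k l → (k ℤ.+ k) ℤ.+ (l ℤ.+ l) ≡ (k ℤ.+ l) ℤ.+ (k ℤ.+ l)
    interchange = ℤS.solve-∀

  evenProduct-sumE : ∀ a b P → All (EvenProduct a b) P → EvenProduct a b (sumE P)
  evenProduct-sumE a b [] [] = evenProduct-zero a b
  evenProduct-sumE a b (x ∷ P) (e ∷ es) = evenProduct-⊕ a b x (sumE P) e (evenProduct-sumE a b P es)

  mul-⊕ : ∀ a b x y → EvenProduct a b x → EvenProduct a b y → mul a b (x ⊕ y) ≡ mul a b x ⊕ mul a b y
  mul-⊕ a b x y ex ey =
    trans (mul-even a b (x ⊕ y) (evenProduct-⊕ a b x y ex ey)) (sym (cong₂ _⊕_ (mul-even a b x ex) (mul-even a b y ey)))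

  mul-sumE : ∀ a b P → All (EvenProduct a b) P → mul a b (sumE P) ≡ sumE (map (mul a b) P)
  mul-sumE a b [] [] = mul-even a b zeroE (evenProduct-zero a b)
  mul-sumE a b (x ∷ P) (e ∷ es) =
    trans (mul-⊕ a b x (sumE P) e (evenProduct-sumE a b P es)) (cong (mul a b x ⊕_) (mul-sumE a b P es))

  mul-inverse : ∀ a b → norm D (a , b) ≡ + 4 → ∀ x → EvenProduct a b x → mul a (ℤ.- b) (mul a b x) ≡ x
  mul-inverse a b N≡4 (u , v) e@((k₁ , e₁) , (k₂ , e₂)) =
    trans (cong (mul a (ℤ.- b)) (mul-even a b (u , v) e)) (cong₂ _,_ first second)
    where
    first-double : ∀ a d b k₁ k₂ → + 2 ℤ.* (a ℤ.* k₁ ℤ.+ d ℤ.* ((ℤ.- b) ℤ.* k₂)) ≡ a ℤ.* (k₁ ℤ.+ k₁) ℤ.- d ℤ.* b ℤ.* (k₂ ℤ.+ k₂)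
    first-double = ℤS.solve-∀
    first-expand : ∀ a d b u v → a ℤ.* (a ℤ.* u ℤ.+ d ℤ.* (b ℤ.* v)) ℤ.- d ℤ.* b ℤ.* (b ℤ.* u ℤ.+ a ℤ.* v) ≡
                                 (a ℤ.* a ℤ.- d ℤ.* (b ℤ.* b)) ℤ.* u
    first-expand = ℤS.solve-∀
    second-double : ∀ a b k₁ k₂ → + 2 ℤ.* ((ℤ.- b) ℤ.* k₁ ℤ.+ a ℤ.* k₂) ≡ a ℤ.* (k₂ ℤ.+ k₂) ℤ.- b ℤ.* (k₁ ℤ.+ k₁)
    second-double = ℤS.solve-∀
    second-expand : ∀ a d b u v → a ℤ.* (b ℤ.* u ℤ.+ a ℤ.* v) ℤ.- b ℤ.* (a ℤ.* u ℤ.+ d ℤ.* (b ℤ.* v)) ≡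
                                  (a ℤ.* a ℤ.- d ℤ.* (b ℤ.* b)) ℤ.* v
    second-expand = ℤS.solve-∀
    four : ∀ u → + 4 ℤ.* u ≡ + 2 ℤ.* (u ℤ.+ u)
    four = ℤS.solve-∀
    first : half (a ℤ.* k₁ ℤ.+ d ℤ.* ((ℤ.- b) ℤ.* k₂)) ≡ u
    first = trans (cong half (ℤP.*-cancelˡ-≡ (+ 2) _ _ (trans (first-double a d b k₁ k₂)
      (trans (cong₂ (λ p q → a ℤ.* p ℤ.- d ℤ.* b ℤ.* q) (sym e₁) (sym e₂))
      (trans (first-expand a d b u v) (trans (cong (ℤ._* u) N≡4) (four u))))))) (half-double u)
    second : half ((ℤ.- b) ℤ.* k₁ ℤ.+ a ℤ.* k₂) ≡ v
    second = trans (cong half (ℤP.*-cancelˡ-≡ (+ 2) _ _ (trans (second-double a b k₁ k₂)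
      (trans (cong₂ (λ p q → a ℤ.* p ℤ.- b ℤ.* q) (sym e₂) (sym e₁))
      (trans (second-expand a d b u v) (trans (cong (ℤ._* v) N≡4) (four v))))))) (half-double v)

  mul-norm : ∀ a b → norm D (a , b) ≡ + 4 → ∀ x → EvenProduct a b x → norm D (mul a b x) ≡ norm D x
  mul-norm a b N≡4 (u , v) e@((k₁ , e₁) , (k₂ , e₂)) = begin
    norm D (mul a b (u , v)) ≡⟨ cong (norm D) (mul-even a b (u , v) e) ⟩
    norm D (k₁ , k₂)         ≡⟨ ℤP.*-cancelˡ-≡ (+ 4) _ _ quadrupled ⟩
    norm D (u , v)           ∎
    where
    open ≡-Reasoning
    double : ∀ d k₁ k₂ → + 4 ℤ.* (k₁ ℤ.* k₁ ℤ.- d ℤ.* (k₂ ℤ.* k₂)) ≡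
                         (k₁ ℤ.+ k₁) ℤ.* (k₁ ℤ.+ k₁) ℤ.- d ℤ.* ((k₂ ℤ.+ k₂) ℤ.* (k₂ ℤ.+ k₂))
    double = ℤS.solve-∀
    brahmagupta : ∀ a d b u v →
      (a ℤ.* u ℤ.+ d ℤ.* (b ℤ.* v)) ℤ.* (a ℤ.* u ℤ.+ d ℤ.* (b ℤ.* v)) ℤ.- d ℤ.* ((b ℤ.* u ℤ.+ a ℤ.* v) ℤ.* (b ℤ.* u ℤ.+ a ℤ.* v))
      ≡ (a ℤ.* a ℤ.- d ℤ.* (b ℤ.* b)) ℤ.* (u ℤ.* u ℤ.- d ℤ.* (v ℤ.* v))
    brahmagupta = ℤS.solve-∀
    quadrupled : + 4 ℤ.* norm D (k₁ , k₂) ≡ + 4 ℤ.* norm D (u , v)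
    quadrupled = begin
      + 4 ℤ.* norm D (k₁ , k₂)   ≡⟨ double d k₁ k₂ ⟩
      norm D (k₁ ℤ.+ k₁ , k₂ ℤ.+ k₂) ≡⟨ cong₂ (λ p q → norm D (p , q)) (sym e₁) (sym e₂) ⟩
      norm D (a ℤ.* u ℤ.+ d ℤ.* (b ℤ.* v) , b ℤ.* u ℤ.+ a ℤ.* v) ≡⟨ brahmagupta a d b u v ⟩
      norm D (a , b) ℤ.* norm D (u , v) ≡⟨ cong (ℤ._* norm D (u , v)) N≡4 ⟩
      + 4 ℤ.* norm D (u , v)     ∎

0<n+i : ∀ n i → ∣ i ∣ ℕ.< n → 0ℤ ℤ.< + n ℤ.+ i
0<n+i n (+ m) m<n = +<+ (ℕP.<-≤-trans (ℕP.≤-<-trans z≤n m<n) (ℕP.m≤m+n n m))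
0<n+i n -[1+ m ] m<n = subst (0ℤ ℤ.<_) (sym (ℤP.⊖-≥ (ℕP.<⇒≤ m<n))) (+<+ (ℕP.m<n⇒0<n∸m m<n))

-- (Dbv)² = Db²·Dv² < (Db² + 4)·u² = (Au)², so Au + Dbv > 0.
mul-trace-positive : ∀ D A b x → A ℕ.* A ≡ D ℕ.* (∣ b ∣ ℕ.* ∣ b ∣) ℕ.+ 4 → Positive D x →
  0ℤ ℤ.< + A ℤ.* proj₁ x ℤ.+ + D ℤ.* (b ℤ.* proj₂ x)
mul-trace-positive D A b x A²≡ x≻0 with positive⇒view D x x≻0
mul-trace-positive D A b (_ , v) A²≡ _ | positiveView U refl U>0 Dv²<U² =
  subst (λ z → 0ℤ ℤ.< z ℤ.+ + D ℤ.* (b ℤ.* v)) (ℤP.pos-* A U) (0<n+i (A ℕ.* U) (+ D ℤ.* (b ℤ.* v)) Dbv<AU)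
  where
  B² = D ℕ.* (∣ b ∣ ℕ.* ∣ b ∣)
  |Dbv| : ∣ + D ℤ.* (b ℤ.* v) ∣ ≡ D ℕ.* (∣ b ∣ ℕ.* ∣ v ∣)
  |Dbv| = trans (ℤP.abs-* (+ D) (b ℤ.* v)) (cong (D ℕ.*_) (ℤP.abs-* b v))
  factor : ∀ D b v → (D ℕ.* (b ℕ.* v)) ℕ.* (D ℕ.* (b ℕ.* v)) ≡ (D ℕ.* (b ℕ.* b)) ℕ.* (D ℕ.* (v ℕ.* v))
  factor = ℕS.solve-∀
  expand : ∀ X U → (X ℕ.+ 4) ℕ.* (U ℕ.* U) ≡ X ℕ.* (U ℕ.* U) ℕ.+ 4 ℕ.* (U ℕ.* U)
  expand = ℕS.solve-∀
  regroup : ∀ A U → (A ℕ.* A) ℕ.* (U ℕ.* U) ≡ (A ℕ.* U) ℕ.* (A ℕ.* U)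
  regroup = ℕS.solve-∀
  4U²>0 : 0 ℕ.< 4 ℕ.* (U ℕ.* U)
  4U²>0 = ℕP.*-monoʳ-< 4 (ℕP.*-mono-< U>0 U>0)
  squares : D ℕ.* (∣ b ∣ ℕ.* ∣ v ∣) ℕ.* (D ℕ.* (∣ b ∣ ℕ.* ∣ v ∣)) ℕ.< (A ℕ.* U) ℕ.* (A ℕ.* U)
  squares = begin-strict
    D ℕ.* (∣ b ∣ ℕ.* ∣ v ∣) ℕ.* (D ℕ.* (∣ b ∣ ℕ.* ∣ v ∣)) ≡⟨ factor D ∣ b ∣ ∣ v ∣ ⟩
    B² ℕ.* (D ℕ.* (∣ v ∣ ℕ.* ∣ v ∣))                   ≤⟨ ℕP.*-monoʳ-≤ B² (ℕP.<⇒≤ Dv²<U²) ⟩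
    B² ℕ.* (U ℕ.* U)                                   <⟨ ℕP.m<m+n (B² ℕ.* (U ℕ.* U)) 4U²>0 ⟩
    B² ℕ.* (U ℕ.* U) ℕ.+ 4 ℕ.* (U ℕ.* U)               ≡⟨ sym (expand B² U) ⟩
    (B² ℕ.+ 4) ℕ.* (U ℕ.* U)                           ≡⟨ cong (ℕ._* (U ℕ.* U)) (sym A²≡) ⟩
    (A ℕ.* A) ℕ.* (U ℕ.* U)                            ≡⟨ regroup A U ⟩
    (A ℕ.* U) ℕ.* (A ℕ.* U)                            ∎
    where open ℕP.≤-Reasoning
  Dbv<AU : ∣ + D ℤ.* (b ℤ.* v) ∣ ℕ.< A ℕ.* U
  Dbv<AU = subst (ℕ._< A ℕ.* U) (sym |Dbv|) (m*m<n*n⇒m<n squares)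

mul-totPos : ∀ D A b → norm D (+ A , b) ≡ + 4 → ∀ x → EvenProduct D (+ A) b x → TotPos D x → TotPos D (mul D (+ A) b x)
mul-totPos D A b N≡4 (u , v) e@((k₁ , e₁) , (k₂ , _)) x≻0@(4∣N , _) =
  subst (TotPos D) (sym (mul-even D (+ A) b (u , v) e)) (4∣N′ , 0<k₁ , 0<norm⇒Dv²<u² D (k₁ , k₂) 0<N′)
  where
  N′≡N : norm D (k₁ , k₂) ≡ norm D (u , v)
  N′≡N = trans (cong (norm D) (sym (mul-even D (+ A) b (u , v) e))) (mul-norm D (+ A) b N≡4 (u , v) e)
  4∣N′ : InOK D (k₁ , k₂)
  4∣N′ = subst (+ 4 ℤD.∣_) (sym N′≡N) 4∣N
  0<N′ : 0ℤ ℤ.< norm D (k₁ , k₂)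
  0<N′ = subst (0ℤ ℤ.<_) (sym N′≡N) (positive⇒0<norm D (u , v) (TotPos⇒Positive {D} {u , v} x≻0))
  0<k₁ : 0ℤ ℤ.< k₁
  0<k₁ = 0<k+k⇒0<k k₁ (subst (0ℤ ℤ.<_) e₁
    (mul-trace-positive D A b (u , v) (norm≡4⇒ℕ D A b N≡4) (TotPos⇒Positive {D} {u , v} x≻0)))

-- ε = (2 + a + b√D)/2 with 4N(ε) = 4; the trace is written 2 + a because the
-- reduction bound below is phrased in terms of a.
record NormOneUnit (D : ℕ) : Set where
  field
    a : ℕ
    b : ℤ
  A : ℕ
  A = 2 ℕ.+ a
  field
    norm≡4 : norm D (+ A , b) ≡ + 4
    evenProduct : ∀ x → TotPos D x → EvenProduct D (+ A) b x
    evenProduct′ : ∀ x → TotPos D x → EvenProduct D (+ A) (ℤ.- b) x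

  conjugate-norm≡4 : norm D (+ A , ℤ.- b) ≡ + 4
  conjugate-norm≡4 = trans (cong (λ z → + A ℤ.* + A ℤ.- + D ℤ.* z) (neg-square b)) norm≡4
    where
    neg-square : ∀ b → (ℤ.- b) ℤ.* (ℤ.- b) ≡ b ℤ.* b
    neg-square = ℤS.solve-∀

  symmetry : PartitionSymmetry D
  symmetry = record
    { f = mul D (+ A) b
    ; g = mul D (+ A) (ℤ.- b)
    ; f-totPos = λ x x≻0 → mul-totPos D A b norm≡4 x (evenProduct x x≻0) x≻0
    ; g-totPos = λ x x≻0 → mul-totPos D A (ℤ.- b) conjugate-norm≡4 x (evenProduct′ x x≻0) x≻0
    ; g∘f = λ x x≻0 → mul-inverse D (+ A) b norm≡4 x (evenProduct x x≻0)
    ; f∘g = λ x x≻0 → subst (λ c → mul D (+ A) c (mul D (+ A) (ℤ.- b) x) ≡ x) (ℤP.neg-involutive b)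
                        (mul-inverse D (+ A) (ℤ.- b) conjugate-norm≡4 x (evenProduct′ x x≻0))
    ; f-sumE = λ P P≻0 → mul-sumE D (+ A) b P (All.map (evenProduct _) P≻0)
    ; g-sumE = λ P P≻0 → mul-sumE D (+ A) (ℤ.- b) P (All.map (evenProduct′ _) P≻0)
    }

evenProduct-double : ∀ D a b x → EvenProduct D (a ℤ.+ a) (b ℤ.+ b) x
evenProduct-double D a b (u , v) = (a ℤ.* u ℤ.+ + D ℤ.* (b ℤ.* v) , first a b (+ D) u v) , (b ℤ.* u ℤ.+ a ℤ.* v , second a b u v)
  where
  first : ∀ a b d u v → (a ℤ.+ a) ℤ.* u ℤ.+ d ℤ.* ((b ℤ.+ b) ℤ.* v) ≡ (a ℤ.* u ℤ.+ d ℤ.* (b ℤ.* v)) ℤ.+ (a ℤ.* u ℤ.+ d ℤ.* (b ℤ.* v))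
  first = ℤS.solve-∀
  second : ∀ a b u v → (b ℤ.+ b) ℤ.* u ℤ.+ (a ℤ.+ a) ℤ.* v ≡ (b ℤ.* u ℤ.+ a ℤ.* v) ℤ.+ (b ℤ.* u ℤ.+ a ℤ.* v)
  second = ℤS.solve-∀

evenProduct-sameParity : ∀ D a b h h′ → a ℤ.+ + D ℤ.* b ≡ h ℤ.+ h → b ℤ.+ a ≡ h′ ℤ.+ h′ →
  ∀ u v → (∃ λ k → u ≡ v ℤ.+ (k ℤ.+ k)) → EvenProduct D a b (u , v)
evenProduct-sameParity D a b h h′ a+Db≡2h b+a≡2h′ u v (k , refl) =
  (h ℤ.* v ℤ.+ a ℤ.* k , trans (first a (+ D) b v k) (trans (cong (λ z → z ℤ.* v ℤ.+ (a ℤ.* k ℤ.+ a ℤ.* k)) a+Db≡2h) (halve h v a k))) ,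
  (h′ ℤ.* v ℤ.+ b ℤ.* k , trans (second a b v k) (trans (cong (λ z → z ℤ.* v ℤ.+ (b ℤ.* k ℤ.+ b ℤ.* k)) b+a≡2h′) (halve h′ v b k)))
  where
  first : ∀ a d b v k → a ℤ.* (v ℤ.+ (k ℤ.+ k)) ℤ.+ d ℤ.* (b ℤ.* v) ≡ (a ℤ.+ d ℤ.* b) ℤ.* v ℤ.+ (a ℤ.* k ℤ.+ a ℤ.* k)
  first = ℤS.solve-∀
  second : ∀ a b v k → b ℤ.* (v ℤ.+ (k ℤ.+ k)) ℤ.+ a ℤ.* v ≡ (b ℤ.+ a) ℤ.* v ℤ.+ (b ℤ.* k ℤ.+ b ℤ.* k)
  second = ℤS.solve-∀
  halve : ∀ h v a k → (h ℤ.+ h) ℤ.* v ℤ.+ (a ℤ.* k ℤ.+ a ℤ.* k) ≡ (h ℤ.* v ℤ.+ a ℤ.* k) ℤ.+ (h ℤ.* v ℤ.+ a ℤ.* k)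
  halve = ℤS.solve-∀

2∣n*n⇒2∣n : ∀ n → 2 ℕD.∣ n ℕ.* n → 2 ℕD.∣ n
2∣n*n⇒2∣n n 2∣n² with euclidsLemma n n prime[2] 2∣n²
... | inj₁ 2∣n = 2∣n
... | inj₂ 2∣n = 2∣n

4∣n*n⇒2∣n : ∀ n → 4 ℕD.∣ n ℕ.* n → 2 ℕD.∣ n
4∣n*n⇒2∣n n 4∣n² = 2∣n*n⇒2∣n n (ℕD.∣-trans (ℕD.divides 2 refl) 4∣n²)

-- For D = 1 + 4j, (u − v)² = 4N + 4jv² − 2(u − v)v is even.
2∣u-v : ∀ j u v → InOK (suc (4 ℕ.* j)) (u , v) → + 2 ℤDS.∣ u ℤ.- v
2∣u-v j u v 4∣N = ℤDS.∣ᵤ⇒∣ (2∣n*n⇒2∣n ∣ r ∣ (subst (2 ℕD.∣_) (ℤP.abs-* r r) (ℤDS.∣⇒∣ᵤ 2∣r²)))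
  where
  r = u ℤ.- v
  identity : ∀ u v j → (u ℤ.- v) ℤ.* (u ℤ.- v) ≡
    (u ℤ.* u ℤ.- (+ 1 ℤ.+ + 4 ℤ.* j) ℤ.* (v ℤ.* v)) ℤ.+ + 4 ℤ.* (j ℤ.* (v ℤ.* v)) ℤ.- + 2 ℤ.* ((u ℤ.- v) ℤ.* v)
  identity = ℤS.solve-∀
  D≡ : + suc (4 ℕ.* j) ≡ + 1 ℤ.+ + 4 ℤ.* + j
  D≡ = trans (ℤP.pos-+ 1 (4 ℕ.* j)) (cong (ℤ._+_ (+ 1)) (ℤP.pos-* 4 j))
  r²≡ : r ℤ.* r ≡ norm (suc (4 ℕ.* j)) (u , v) ℤ.+ + 4 ℤ.* (+ j ℤ.* (v ℤ.* v)) ℤ.- + 2 ℤ.* (r ℤ.* v)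
  r²≡ = trans (identity u v (+ j))
    (cong (λ D → (u ℤ.* u ℤ.- D ℤ.* (v ℤ.* v)) ℤ.+ + 4 ℤ.* (+ j ℤ.* (v ℤ.* v)) ℤ.- + 2 ℤ.* (r ℤ.* v)) (sym D≡))
  2∣4 : + 2 ℤDS.∣ + 4
  2∣4 = ℤDS.divides (+ 2) refl
  2∣r² : + 2 ℤDS.∣ r ℤ.* r
  2∣r² = subst (+ 2 ℤDS.∣_) (sym r²≡)
    (ℤDS.∣m∣n⇒∣m-n (ℤDS.∣m∣n⇒∣m+n (ℤDS.∣-trans 2∣4 (ℤDS.∣ᵤ⇒∣ {+ 4} {norm (suc (4 ℕ.* j)) (u , v)} 4∣N)) (ℤDS.∣-trans 2∣4 (ℤDS.∣m⇒∣m*n _ ℤDS.∣-refl)))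
      (ℤDS.∣m⇒∣m*n _ ℤDS.∣-refl))

sameParity : ∀ j u v → InOK (suc (4 ℕ.* j)) (u , v) → ∃ λ k → u ≡ v ℤ.+ (k ℤ.+ k)
sameParity j u v 4∣N = k , trans (sym (v+[u-v]≡u v u)) (cong (ℤ._+_ v) (trans u-v≡k*2 (k*2≡k+k k)))
  where
  open ℤDS._∣_ (2∣u-v j u v 4∣N) renaming (quotient to k; equality to u-v≡k*2)
  v+[u-v]≡u : ∀ v u → v ℤ.+ (u ℤ.- v) ≡ u
  v+[u-v]≡u = ℤS.solve-∀
  k*2≡k+k : ∀ k → k ℤ.* + 2 ≡ k ℤ.+ k
  k*2≡k+k = ℤS.solve-∀

enumerableᵇ : ℕ → Elt → Bool
enumerableᵇ D α = isYes (totPos? D α) ∧ distinctᵇ (partitionsOf D α)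

enumerableᵇ-sound : ∀ D α → 1 ℕ.≤ D → T (enumerableᵇ D α) → TotPos D α × PartitionCount D α (length (partitionsOf D α))
enumerableᵇ-sound D α D≥1 t with Equivalence.to T-∧ t
... | α≻0 , distinct = toWitness {a? = totPos? D α} α≻0 , partitionCount-partitionsOf D α D≥1 (toWitness {a? = totPos? D α} α≻0) distinct

countsᵇ : ℕ → ℕ → Elt → Bool
countsᵇ D m α = enumerableᵇ D α ∧ (m ℕ.≡ᵇ length (partitionsOf D α))

countsᵇ-sound : ∀ D m α → 1 ℕ.≤ D → T (countsᵇ D m α) → TotPos D α × PartitionCount D α m
countsᵇ-sound D m α D≥1 t with Equivalence.to T-∧ t
... | e , m≡ with enumerableᵇ-sound D α D≥1 e
... | α≻0 , count = α≻0 , subst (PartitionCount D α) (sym (ℕP.≡ᵇ⇒≡ m _ m≡)) count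

avoidsᵇ : ℕ → ℕ → Elt → Bool
avoidsᵇ D m α = enumerableᵇ D α ∧ not (m ℕ.≡ᵇ length (partitionsOf D α))

avoidsᵇ-sound : ∀ D m α → 1 ℕ.≤ D → T (avoidsᵇ D m α) → ¬ PartitionCount D α m
avoidsᵇ-sound D m α D≥1 t pm with Equivalence.to T-∧ t
... | e , m≢ with enumerableᵇ-sound D α D≥1 e
... | _ , count = subst T (Equivalence.to T-not-≡ m≢) (ℕP.≡⇒≡ᵇ m _ (partitionCount-unique {D} {α} pm count))

Exceeds : ℕ → ℕ → Elt → Set
Exceeds D m β = ∃ λ k → m ℕ.< k × PartitionCount D β k

exceedsᵇ : ℕ → ℕ → Elt → Bool
exceedsᵇ D m β = enumerableᵇ D β ∧ (m ℕ.<ᵇ length (partitionsOf D β))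

exceedsᵇ-sound : ∀ D m β → 1 ℕ.≤ D → T (exceedsᵇ D m β) → Exceeds D m β
exceedsᵇ-sound D m β D≥1 t with Equivalence.to T-∧ t
... | e , m< = _ , ℕP.<ᵇ⇒< m _ m< , proj₂ (enumerableᵇ-sound D β D≥1 e)

exceeds-≽ : ∀ {D m α β} → α ≽[ D ] β → Exceeds D m β → ¬ PartitionCount D α m
exceeds-≽ {D} {m} {α} {β} α≽β (k , m<k , pk) pm = ℕP.<⇒≱ m<k (partitionCount-mono {D} {α} {β} α≽β pk pm)

-- Reduction by a unit

-- Writing U = (B + 1) + w, each coefficient of w in the comparison already has the right sign.
quadratic-escape : ∀ c₁ c₂ K B → K ℕ.≤ suc B →
  c₂ ℕ.* (suc B ℕ.* suc B) ℕ.< c₁ ℕ.* ((suc B ℕ.∸ K) ℕ.* (suc B ℕ.∸ K)) →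
  c₂ ℕ.* suc B ℕ.≤ c₁ ℕ.* (suc B ℕ.∸ K) → c₂ ℕ.≤ c₁ →
  ∀ U → B ℕ.< U → c₂ ℕ.* (U ℕ.* U) ℕ.< c₁ ℕ.* ((U ℕ.∸ K) ℕ.* (U ℕ.∸ K))
quadratic-escape c₁ c₂ K B K≤ at-B+1 slope c₂≤c₁ U B<U =
  subst₂ (λ p q → c₂ ℕ.* (q ℕ.* q) ℕ.< c₁ ℕ.* (p ℕ.* p)) (sym U∸K≡) U≡
    (subst₂ ℕ._<_ (sym (expand c₂ (suc B) w)) (sym (expand c₁ x w))
      (ℕP.+-mono-<-≤ (ℕP.+-mono-<-≤ at-B+1 (ℕP.*-monoˡ-≤ w (ℕP.*-monoʳ-≤ 2 slope))) (ℕP.*-monoˡ-≤ (w ℕ.* w) c₂≤c₁)))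
  where
  w = U ℕ.∸ suc B
  x = suc B ℕ.∸ K
  U≡ : suc B ℕ.+ w ≡ U
  U≡ = ℕP.m+[n∸m]≡n B<U
  U∸K≡ : U ℕ.∸ K ≡ x ℕ.+ w
  U∸K≡ = trans (cong (ℕ._∸ K) (sym U≡)) (ℕP.+-∸-comm w K≤)
  expand : ∀ c x w → c ℕ.* ((x ℕ.+ w) ℕ.* (x ℕ.+ w)) ≡ c ℕ.* (x ℕ.* x) ℕ.+ 2 ℕ.* (c ℕ.* x) ℕ.* w ℕ.+ c ℕ.* (w ℕ.* w)
  expand = ℕS.solve-∀

shrink : ∀ {i j n} → 0ℤ ℤ.< i → i ℤ.< j → ∣ j ∣ ℕ.≤ suc n → ∣ i ∣ ℕ.≤ n
shrink (+<+ _) (+<+ i<j) j≤ = ℕP.≤-pred (ℕP.≤-trans i<j j≤)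

0≤x+y⇒0≤y : ∀ x y → x ℤ.≤ x ℤ.+ y → 0ℤ ℤ.≤ y
0≤x+y⇒0≤y x y x≤x+y = subst₂ ℤ._≤_ (ℤP.+-inverseˡ x) (cancel x y) (ℤP.+-monoʳ-≤ (ℤ.- x) x≤x+y)
  where
  cancel : ∀ x y → ℤ.- x ℤ.+ (x ℤ.+ y) ≡ y
  cancel = ℤS.solve-∀

0≤n±i⇒∣i∣≤n : ∀ n i → 0ℤ ℤ.≤ + n ℤ.+ i → 0ℤ ℤ.≤ + n ℤ.+ ℤ.- i → ∣ i ∣ ℕ.≤ n
0≤n±i⇒∣i∣≤n n i 0≤n+i 0≤n-i with ℤP.+∣i∣≡i⊎+∣i∣≡-i i
... | inj₁ ∣i∣≡i = ℤP.drop‿+≤+ (subst (ℤ._≤ + n) (sym ∣i∣≡i) (ℤP.0≤i-j⇒j≤i 0≤n-i))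
... | inj₂ ∣i∣≡-i = ℤP.drop‿+≤+ (subst (ℤ._≤ + n) (sym ∣i∣≡-i)
  (ℤP.0≤i-j⇒j≤i (subst (λ j → 0ℤ ℤ.≤ + n ℤ.+ j) (sym (ℤP.neg-involutive i)) 0≤n+i)))

module Reduction {D : ℕ} (D≥1 : 1 ℕ.≤ D) (ε : NormOneUnit D) where
  open NormOneUnit ε
  open PartitionSymmetry symmetry using (f-totPos; g-totPos; partitionCount-symmetry; inverse)
    renaming (f to times-ε; g to times-ε⁻¹)

  Reduced : Elt → Set
  Reduced α = trace α ℤ.≤ trace (times-ε α) × trace α ℤ.≤ trace (times-ε⁻¹ α)

  reduced? : ∀ α → Dec (Reduced α)
  reduced? α = (trace α ℤ.≤? trace (times-ε α)) ×-dec (trace α ℤ.≤? trace (times-ε⁻¹ α))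

  reduce : ∀ {m} n α → ∣ trace α ∣ ℕ.≤ n → TotPos D α → PartitionCount D α m →
    ∃ λ α′ → TotPos D α′ × Reduced α′ × PartitionCount D α′ m
  reduce zero (+ zero , _) _ (_ , +<+ () , _) _
  reduce zero (-[1+ _ ] , _) _ (_ , () , _) _
  reduce (suc n) α |u|≤ α≻0 pm with trace α ℤ.≤? trace (times-ε α) | trace α ℤ.≤? trace (times-ε⁻¹ α)
  ... | no α≰εα | _ = reduce n (times-ε α) (shrink (proj₁ (proj₂ εα≻0)) (ℤP.≰⇒> α≰εα) |u|≤) εα≻0
    (partitionCount-symmetry {α} α≻0 pm)
    where εα≻0 = f-totPos α α≻0
  ... | yes _ | no α≰ε⁻¹α = reduce n (times-ε⁻¹ α) (shrink (proj₁ (proj₂ ε⁻¹α≻0)) (ℤP.≰⇒> α≰ε⁻¹α) |u|≤) ε⁻¹α≻0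
    (PartitionSymmetry.partitionCount-symmetry inverse {α} α≻0 pm)
    where ε⁻¹α≻0 = g-totPos α α≻0
  ... | yes α≤εα | yes α≤ε⁻¹α = α , α≻0 , (α≤εα , α≤ε⁻¹α) , pm

  private
    -- u ≤ Tr(ε′α) = ((2 + a)u + Dcv)/2 says exactly 0 ≤ au + Dcv.
    0≤au+Dcv : ∀ c u v → EvenProduct D (+ A) c (u , v) → u ℤ.≤ trace (mul D (+ A) c (u , v)) →
      0ℤ ℤ.≤ + a ℤ.* u ℤ.+ + D ℤ.* (c ℤ.* v)
    0≤au+Dcv c u v e@((k₁ , e₁) , _) u≤ = 0≤x+y⇒0≤y (u ℤ.+ u) _
      (subst (u ℤ.+ u ℤ.≤_) (trans (sym e₁) (split (+ a) u (+ D ℤ.* (c ℤ.* v)))) (ℤP.+-mono-≤ u≤k₁ u≤k₁))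
      where
      u≤k₁ = subst (u ℤ.≤_) (cong proj₁ (mul-even D (+ A) c (u , v) e)) u≤
      split : ∀ a u z → (+ 2 ℤ.+ a) ℤ.* u ℤ.+ z ≡ (u ℤ.+ u) ℤ.+ (a ℤ.* u ℤ.+ z)
      split = ℤS.solve-∀

  reduced⇒Dbv≤aU : ∀ U v → TotPos D (+ U , v) → Reduced (+ U , v) → D ℕ.* (∣ b ∣ ℕ.* ∣ v ∣) ℕ.≤ a ℕ.* U
  reduced⇒Dbv≤aU U v α≻0 (α≤εα , α≤ε⁻¹α) = subst (ℕ._≤ a ℕ.* U) |Dbv|
    (0≤n±i⇒∣i∣≤n (a ℕ.* U) (+ D ℤ.* (b ℤ.* v))
      (subst (λ p → 0ℤ ℤ.≤ p ℤ.+ _) (sym (ℤP.pos-* a U)) (0≤au+Dcv b (+ U) v (evenProduct (+ U , v) α≻0) α≤εα))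
      (subst (λ p → 0ℤ ℤ.≤ p) (cong₂ ℤ._+_ (sym (ℤP.pos-* a U)) (negate (+ D) b v))
        (0≤au+Dcv (ℤ.- b) (+ U) v (evenProduct′ (+ U , v) α≻0) α≤ε⁻¹α)))
    where
    |Dbv| : ∣ + D ℤ.* (b ℤ.* v) ∣ ≡ D ℕ.* (∣ b ∣ ℕ.* ∣ v ∣)
    |Dbv| = trans (ℤP.abs-* (+ D) (b ℤ.* v)) (cong (D ℕ.*_) (ℤP.abs-* b v))
    negate : ∀ d b v → d ℤ.* ((ℤ.- b) ℤ.* v) ≡ ℤ.- (d ℤ.* (b ℤ.* v))
    negate = ℤS.solve-∀

  -- If (U − 2M)² > Dv², then α − M is totally positive (its norm differs from that of α by a multiple of 4).
  below⇒U∸2M≤Dv² : ∀ M U v → TotPos D (+ U , v) → ¬ (+ U , v) ≽[ D ] fromℕ M → M ℕ.+ M ℕ.≤ U →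
    (U ℕ.∸ (M ℕ.+ M)) ℕ.* (U ℕ.∸ (M ℕ.+ M)) ℕ.≤ D ℕ.* (∣ v ∣ ℕ.* ∣ v ∣)
  below⇒U∸2M≤Dv² M U v (4∣N , _) α⋡M 2M≤U with D ℕ.* (∣ v ∣ ℕ.* ∣ v ∣) ℕ.<? (U ℕ.∸ K) ℕ.* (U ℕ.∸ K)
    where K = M ℕ.+ M
  ... | no Dv²≮ = ℕP.≮⇒≥ Dv²≮
  ... | yes Dv²< = ⊥-elim (α⋡M (inj₂ (4∣N′ , view⇒positive D ((+ U , v) ⊖ fromℕ M)
        (positiveView (U ℕ.∸ K) u′≡ (0<U∸K Dv²<) (subst (λ w → D ℕ.* (∣ w ∣ ℕ.* ∣ w ∣) ℕ.< _) (sym (ℤP.+-identityʳ v)) Dv²<)))))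
    where
    K = M ℕ.+ M
    0<U∸K : ∀ {c n} → c ℕ.< n ℕ.* n → 0 ℕ.< n
    0<U∸K {n = suc _} _ = s≤s z≤n
    u′≡ : + U ℤ.- + K ≡ + (U ℕ.∸ K)
    u′≡ = trans (ℤP.m-n≡m⊖n U K) (ℤP.⊖-≥ 2M≤U)
    translate : ∀ u M d v → (u ℤ.- (M ℤ.+ M)) ℤ.* (u ℤ.- (M ℤ.+ M)) ℤ.- d ℤ.* ((v ℤ.- 0ℤ) ℤ.* (v ℤ.- 0ℤ)) ≡
                        (u ℤ.* u ℤ.- d ℤ.* (v ℤ.* v)) ℤ.+ + 4 ℤ.* (M ℤ.* M ℤ.- M ℤ.* u)
    translate = ℤS.solve-∀
    N′≡ : norm D ((+ U , v) ⊖ fromℕ M) ≡ norm D (+ U , v) ℤ.+ + 4 ℤ.* (+ M ℤ.* + M ℤ.- + M ℤ.* + U)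
    N′≡ = trans (cong (λ c → (+ U ℤ.- c) ℤ.* (+ U ℤ.- c) ℤ.- + D ℤ.* ((v ℤ.- 0ℤ) ℤ.* (v ℤ.- 0ℤ))) (ℤP.pos-+ M M))
                (translate (+ U) (+ M) (+ D) v)
    4∣N′ : InOK D ((+ U , v) ⊖ fromℕ M)
    4∣N′ = ℤDS.∣⇒∣ᵤ (subst (+ 4 ℤDS.∣_) (sym N′≡)
      (ℤDS.∣m∣n⇒∣m+n (ℤDS.∣ᵤ⇒∣ {+ 4} {norm D (+ U , v)} 4∣N) (ℤDS.∣m⇒∣m*n _ ℤDS.∣-refl)))

  BoundConditions : ℕ → ℕ → Set
  BoundConditions M B =
    (M ℕ.+ M ℕ.≤ suc B) ×
    (a ℕ.* a ℕ.* (suc B ℕ.* suc B) ℕ.< D ℕ.* (∣ b ∣ ℕ.* ∣ b ∣) ℕ.* ((suc B ℕ.∸ (M ℕ.+ M)) ℕ.* (suc B ℕ.∸ (M ℕ.+ M)))) ×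
    (a ℕ.* a ℕ.* suc B ℕ.≤ D ℕ.* (∣ b ∣ ℕ.* ∣ b ∣) ℕ.* (suc B ℕ.∸ (M ℕ.+ M))) ×
    (a ℕ.* a ℕ.≤ D ℕ.* (∣ b ∣ ℕ.* ∣ b ∣))

  boundConditions? : ∀ M B → Dec (BoundConditions M B)
  boundConditions? M B = (_ ℕ.≤? _) ×-dec (_ ℕ.<? _) ×-dec (_ ℕ.≤? _) ×-dec (_ ℕ.≤? _)

  -- Reduced elements below the rational integer M have bounded trace: |Dbv| ≤ aU and
  -- (U − 2M)² ≤ Dv² give Db²(U − 2M)² ≤ a²U², which fails beyond B.
  reduced-trace-bound : ∀ M B → BoundConditions M B →
    ∀ α → TotPos D α → Reduced α → ¬ α ≽[ D ] fromℕ M → ∣ trace α ∣ ℕ.≤ B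
  reduced-trace-bound M B (2M≤ , at-B+1 , slope , a²≤Db²) (u , v) α≻0 α-reduced α⋡M
    with positive⇒view D (u , v) (TotPos⇒Positive {D} {u , v} α≻0)
  ... | positiveView U refl _ _ with U ℕ.≤? B
  ...   | yes U≤B = U≤B
  ...   | no U≰B = ⊥-elim (ℕP.<⇒≱ (quadratic-escape _ _ K B 2M≤ at-B+1 slope a²≤Db² U U>B) squares)
    where
    K = M ℕ.+ M
    U>B = ℕP.≰⇒> U≰B
    Dbv = D ℕ.* (∣ b ∣ ℕ.* ∣ v ∣)
    Dbv≤aU : Dbv ℕ.≤ a ℕ.* U
    Dbv≤aU = reduced⇒Dbv≤aU U v α≻0 α-reduced
    factor : ∀ D b v → (D ℕ.* (b ℕ.* b)) ℕ.* (D ℕ.* (v ℕ.* v)) ≡ (D ℕ.* (b ℕ.* v)) ℕ.* (D ℕ.* (b ℕ.* v))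
    factor = ℕS.solve-∀
    regroup : ∀ a U → (a ℕ.* U) ℕ.* (a ℕ.* U) ≡ (a ℕ.* a) ℕ.* (U ℕ.* U)
    regroup = ℕS.solve-∀
    squares : D ℕ.* (∣ b ∣ ℕ.* ∣ b ∣) ℕ.* ((U ℕ.∸ K) ℕ.* (U ℕ.∸ K)) ℕ.≤ a ℕ.* a ℕ.* (U ℕ.* U)
    squares = begin
      D ℕ.* (∣ b ∣ ℕ.* ∣ b ∣) ℕ.* ((U ℕ.∸ K) ℕ.* (U ℕ.∸ K))
        ≤⟨ ℕP.*-monoʳ-≤ (D ℕ.* (∣ b ∣ ℕ.* ∣ b ∣))
             (below⇒U∸2M≤Dv² M U v α≻0 α⋡M (ℕP.≤-trans 2M≤ U>B)) ⟩
      D ℕ.* (∣ b ∣ ℕ.* ∣ b ∣) ℕ.* (D ℕ.* (∣ v ∣ ℕ.* ∣ v ∣)) ≡⟨ factor D ∣ b ∣ ∣ v ∣ ⟩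
      Dbv ℕ.* Dbv                                           ≤⟨ ℕP.*-mono-≤ Dbv≤aU Dbv≤aU ⟩
      (a ℕ.* U) ℕ.* (a ℕ.* U)                               ≡⟨ regroup a U ⟩
      a ℕ.* a ℕ.* (U ℕ.* U)                                 ∎
      where open ℕP.≤-Reasoning

  Settled : ℕ → List Elt → Elt → Set
  Settled m bigs x = ¬ TotPos D x ⊎ ¬ Reduced x ⊎ Any (x ≽[ D ]_) bigs ⊎ T (avoidsᵇ D m x)

  settled? : ∀ m bigs x → Dec (Settled m bigs x)
  settled? m bigs x = ¬? (totPos? D x) ⊎-dec ¬? (reduced? x) ⊎-dec any? (x ≽?[ D ]_) bigs ⊎-dec T? (avoidsᵇ D m x)

  -- Every reduced α below the rational integer M lies in box B; each element of the box
  -- either is not a reduced totally positive element, lies above an element with more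
  -- than m partitions, or has its partitions enumerated.
  Certificate : ℕ → ℕ → ℕ → List Elt → Set
  Certificate m M B bigs =
    BoundConditions M B × All (T ∘ exceedsᵇ D m) (fromℕ M ∷ bigs) × All (Settled m bigs) (box B)

  certificate? : ∀ m M B bigs → Dec (Certificate m M B bigs)
  certificate? m M B bigs =
    boundConditions? M B ×-dec All.all? (T? ∘ exceedsᵇ D m) (fromℕ M ∷ bigs) ×-dec All.all? (settled? m bigs) (box B)

  certified-excluded : ∀ m M B bigs → Certificate m M B bigs → InDset m D
  certified-excluded m M B bigs (bounds , (M-exceeds ∷ bigs-exceed) , box-settled) (α , α≻0 , pα)
    with reduce ∣ trace α ∣ α ℕP.≤-refl α≻0 pα
  ... | α′ , α′≻0 , α′-reduced , pα′ with α′ ≽?[ D ] fromℕ M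
  ...   | yes α′≽M = exceeds-≽ {D} {m} {α′} α′≽M (exceedsᵇ-sound D m (fromℕ M) D≥1 M-exceeds) pα′
  ...   | no α′⋡M with All.lookup box-settled (positive-∈-box α′ D≥1 (TotPos⇒Positive {D} {α′} α′≻0)
                        (reduced-trace-bound M B bounds α′ α′≻0 α′-reduced α′⋡M))
  ...     | inj₁ α′⊁0 = α′⊁0 α′≻0
  ...     | inj₂ (inj₁ α′-unreduced) = α′-unreduced α′-reduced
  ...     | inj₂ (inj₂ (inj₁ α′≽big)) =
    All.lookupWith (λ {β} e α′≽β → exceeds-≽ {D} {m} {α′} {β} α′≽β (exceedsᵇ-sound D m β D≥1 e) pα′) bigs-exceed α′≽big
  ...     | inj₂ (inj₂ (inj₂ avoids)) = avoidsᵇ-sound D m α′ D≥1 avoids pα′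

  excluded : ∀ m M B bigs → True (certificate? m M B bigs) → InDset m D
  excluded m M B bigs c = certified-excluded m M B bigs (toWitness c)

-- Rational integers

rationals : ℕ → List Elt
rationals n = applyUpTo (fromℕ ∘ suc) n

fromℕ-totPos : ∀ D n → TotPos D (fromℕ (suc n))
fromℕ-totPos D n = subst (λ z → + 4 ℤD.∣ (s² ℤ.- z)) (sym (ℤP.*-zeroʳ (+ D))) 4∣s² ,
                   +<+ (s≤s z≤n) ,
                   subst (ℤ._< s²) (sym (ℤP.*-zeroʳ (+ D))) (subst (0ℤ ℤ.<_) (ℤP.pos-* s s) (+<+ (s≤s z≤n)))
  where
  s = suc n ℕ.+ suc n
  s² = + s ℤ.* + s
  double² : ∀ k → (k ℕ.+ k) ℕ.* (k ℕ.+ k) ≡ (k ℕ.* k) ℕ.* 4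
  double² = ℕS.solve-∀
  4∣s² : + 4 ℤD.∣ (s² ℤ.- 0ℤ)
  4∣s² = subst (λ z → 4 ℕD.∣ ∣ z ∣) (sym (trans (ℤP.+-identityʳ s²) (sym (ℤP.pos-* s s))))
    (ℕD.divides (suc n ℕ.* suc n) (double² (suc n)))

rationals-totPos : ∀ D n → All (TotPos D) (rationals n)
rationals-totPos D n = AllP.applyUpTo⁺₂ (fromℕ ∘ suc) n (fromℕ-totPos D)

coefficientSum : List Elt → ℕ
coefficientSum [] = 0
coefficientSum (x ∷ P) = ∣ proj₂ x ∣ ℕ.+ coefficientSum P

module _ {D n : ℕ} (n²≤D : n ℕ.* n ℕ.≤ D) where
  trace>n∣v∣ : ∀ x → TotPos D x → + (n ℕ.* ∣ proj₂ x ∣ ℕ.+ 1) ℤ.≤ trace x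
  trace>n∣v∣ x (_ , x≻0) with positive⇒view D x x≻0
  trace>n∣v∣ (_ , v) _ | positiveView a refl _ Dv²<a² =
    +≤+ (subst (ℕ._≤ a) (ℕP.+-comm 1 (n ℕ.* ∣ v ∣)) (m*m<n*n⇒m<n (ℕP.≤-<-trans nv²≤Dv² Dv²<a²)))
    where
    regroup : ∀ n v → (n ℕ.* v) ℕ.* (n ℕ.* v) ≡ (n ℕ.* n) ℕ.* (v ℕ.* v)
    regroup = ℕS.solve-∀
    nv²≤Dv² : (n ℕ.* ∣ v ∣) ℕ.* (n ℕ.* ∣ v ∣) ℕ.≤ D ℕ.* (∣ v ∣ ℕ.* ∣ v ∣)
    nv²≤Dv² = subst (ℕ._≤ D ℕ.* (∣ v ∣ ℕ.* ∣ v ∣)) (sym (regroup n ∣ v ∣)) (ℕP.*-monoˡ-≤ (∣ v ∣ ℕ.* ∣ v ∣) n²≤D)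

  trace-sumE-lower : ∀ P → All (TotPos D) P → + (n ℕ.* coefficientSum P ℕ.+ length P) ℤ.≤ trace (sumE P)
  trace-sumE-lower [] [] = subst (λ z → + (z ℕ.+ 0) ℤ.≤ 0ℤ) (sym (ℕP.*-zeroʳ n)) (+≤+ z≤n)
  trace-sumE-lower (x ∷ P) (x≻0 ∷ P≻0) =
    subst (ℤ._≤ trace x ℤ.+ trace (sumE P)) (sym (trans (cong +_ (regroup n ∣ proj₂ x ∣ (coefficientSum P) (length P)))
      (ℤP.pos-+ (n ℕ.* ∣ proj₂ x ∣ ℕ.+ 1) (n ℕ.* coefficientSum P ℕ.+ length P))))
      (ℤP.+-mono-≤ (trace>n∣v∣ x x≻0) (trace-sumE-lower P P≻0))
    where
    regroup : ∀ n V S l → n ℕ.* (V ℕ.+ S) ℕ.+ suc l ≡ (n ℕ.* V ℕ.+ 1) ℕ.+ (n ℕ.* S ℕ.+ l)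
    regroup = ℕS.solve-∀

coefficientSum≡0 : ∀ P → coefficientSum P ≡ 0 → All (λ x → proj₂ x ≡ 0ℤ) P
coefficientSum≡0 [] _ = []
coefficientSum≡0 (x ∷ P) S≡0 =
  ℤP.∣i∣≡0⇒i≡0 (ℕP.m+n≡0⇒m≡0 _ S≡0) ∷ coefficientSum≡0 P (ℕP.m+n≡0⇒n≡0 ∣ proj₂ x ∣ S≡0)

sumE-coefficient≡0 : ∀ P → All (λ x → proj₂ x ≡ 0ℤ) P → proj₂ (sumE P) ≡ 0ℤ
sumE-coefficient≡0 [] [] = refl
sumE-coefficient≡0 (x ∷ P) (v≡0 ∷ vs≡0) = cong₂ ℤ._+_ v≡0 (sumE-coefficient≡0 P vs≡0)

-- A single coefficient ±1 cannot cancel against zeros.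
coefficientSum≤1 : ∀ P → coefficientSum P ℕ.≤ 1 → proj₂ (sumE P) ≡ 0ℤ → All (λ x → proj₂ x ≡ 0ℤ) P
coefficientSum≤1 [] _ _ = []
coefficientSum≤1 ((u , v) ∷ P) S≤1 Σv≡0 with ∣ v ∣ in ∣v∣≡
... | zero = v≡0 ∷ coefficientSum≤1 P S≤1 (trans (sym (trans (cong (ℤ._+ proj₂ (sumE P)) v≡0) (ℤP.+-identityˡ _))) Σv≡0)
  where v≡0 = ℤP.∣i∣≡0⇒i≡0 ∣v∣≡
... | suc zero = ⊥-elim (ℕP.1+n≢0 (trans (sym ∣v∣≡) (cong ∣_∣ v≡0)))
  where
  v≡0 : v ≡ 0ℤ
  v≡0 = trans (sym (ℤP.+-identityʳ v))
    (trans (cong (ℤ._+_ v) (sym (sumE-coefficient≡0 P (coefficientSum≡0 P (ℕP.n≤0⇒n≡0 (ℕP.≤-pred S≤1)))))) Σv≡0)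
... | suc (suc _) with S≤1
...   | s≤s ()

rational-∈ : ∀ D n a → TotPos D (+ a , 0ℤ) → a ℕ.≤ n ℕ.+ n → (+ a , 0ℤ) ∈ rationals n
rational-∈ D n a (4∣N , 0<a , _) a≤2n with 4∣n*n⇒2∣n a 4∣a²
  where
  N≡a² : norm D (+ a , 0ℤ) ≡ + (a ℕ.* a)
  N≡a² = trans (cong (λ z → + a ℤ.* + a ℤ.- z) (ℤP.*-zeroʳ (+ D))) (trans (ℤP.+-identityʳ _) (sym (ℤP.pos-* a a)))
  4∣a² : 4 ℕD.∣ a ℕ.* a
  4∣a² = subst (λ z → 4 ℕD.∣ ∣ z ∣) N≡a² 4∣N
... | ℕD.divides zero refl with 0<a
...   | +<+ ()
rational-∈ D n a (4∣N , 0<a , _) a≤2n | ℕD.divides (suc i) refl =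
  subst (_∈ rationals n) (cong (λ k → + k , 0ℤ) (twice (suc i))) (∈-applyUpTo⁺ (fromℕ ∘ suc) i<n)
  where
  twice : ∀ k → k ℕ.+ k ≡ k ℕ.* 2
  twice = ℕS.solve-∀
  i<n : i ℕ.< n
  i<n = ℕP.*-cancelʳ-≤ (suc i) n 2 (subst (suc i ℕ.* 2 ℕ.≤_) (twice n) a≤2n)

-- For D ≥ n² a partition of the rational integer n has trace 2n ≥ n·Σ|vᵢ| + (number of parts),
-- so all coefficients vanish and the parts are rational integers.
rational-parts : ∀ D n → n ℕ.* n ℕ.≤ D → ∀ P → IsPartition D (fromℕ n) P → All (_∈ rationals n) P
rational-parts D n n²≤D P P-partition@(P≢[] , P≻0 , ΣP≡n) = All.tabulate λ {x} → part∈ x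
  where
  lower : n ℕ.* coefficientSum P ℕ.+ length P ℕ.≤ n ℕ.+ n
  lower = ℤP.drop‿+≤+ (subst (λ z → + (n ℕ.* coefficientSum P ℕ.+ length P) ℤ.≤ trace z) ΣP≡n (trace-sumE-lower {D} {n} n²≤D P P≻0))
  0<|P| : 0 ℕ.< length P
  0<|P| = nonEmpty P P≢[]
    where
    nonEmpty : ∀ (P : List Elt) → ¬ P ≡ [] → 0 ℕ.< length P
    nonEmpty [] P≢[] = ⊥-elim (P≢[] refl)
    nonEmpty (_ ∷ _) _ = s≤s z≤n
  twice : ∀ n → n ℕ.+ n ≡ n ℕ.* 2
  twice = ℕS.solve-∀
  S≤1 : coefficientSum P ℕ.≤ 1
  S≤1 = ℕP.≮⇒≥ λ 1<S → ℕP.<⇒≱ (begin-strict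
    n ℕ.+ n                              ≡⟨ twice n ⟩
    n ℕ.* 2                              ≤⟨ ℕP.*-monoʳ-≤ n 1<S ⟩
    n ℕ.* coefficientSum P               <⟨ ℕP.m<m+n _ 0<|P| ⟩
    n ℕ.* coefficientSum P ℕ.+ length P  ∎) lower
    where open ℕP.≤-Reasoning
  v≡0 = coefficientSum≤1 P S≤1 (cong proj₂ ΣP≡n)
  part∈ : ∀ x → x ∈ P → x ∈ rationals n
  part∈ (u , v) x∈P with All.lookup v≡0 x∈P
  ... | refl with All.lookup P≻0 x∈P
  ...   | x≻0 with positive⇒view D (u , 0ℤ) (TotPos⇒Positive {D} {u , 0ℤ} x≻0)
  ...     | positiveView a refl _ _ =
    rational-∈ D n a x≻0 (summand-trace≤ {D} (fromℕ n) (+ a , 0ℤ) (part⇒summand {D} {fromℕ n} P-partition x∈P))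

-- Enumerated with D′ = 1, these are the classical partitions of n.
rationalPartitions : ℕ → List (List Elt)
rationalPartitions n = multisets 1 (n ℕ.+ n) (rationals n) (fromℕ n)

partitionCount-fromℕ : ∀ D p → suc p ℕ.* suc p ℕ.≤ D → T (distinctᵇ (rationalPartitions (suc p))) →
  PartitionCount D (fromℕ (suc p)) (length (rationalPartitions (suc p)))
partitionCount-fromℕ D p n²≤D = partitionCount-enumerate D 1 (fromℕ (suc p)) (rationals (suc p))
  (rationals-totPos D (suc p)) (rationals-totPos 1 (suc p)) (rational-parts D (suc p) n²≤D) (fromℕ-totPos D p)

-- Classification

HasSquareFactor : ℕ → Set
HasSquareFactor D = Any (λ d → (2 ℕ.+ d) ℕ.* (2 ℕ.+ d) ℕD.∣ D) (upTo D)

hasSquareFactor? : ∀ D → Dec (HasSquareFactor D)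
hasSquareFactor? D = any? (λ d → (2 ℕ.+ d) ℕ.* (2 ℕ.+ d) ℕD.∣? D) (upTo D)

hasSquareFactor⇒¬squareFree : ∀ {D} → HasSquareFactor D → ¬ SquareFree D
hasSquareFactor⇒¬squareFree d²∣D D-squarefree with Any.satisfied d²∣D
... | d , d²∣D with D-squarefree (2 ℕ.+ d) d²∣D
...   | ()

OneOf : List ℕ → ℕ → Set
OneOf [] D = ⊥
OneOf (x ∷ []) D = D ≡ x
OneOf (x ∷ y ∷ xs) D = D ≡ x ⊎ OneOf (y ∷ xs) D

∈⇒OneOf : ∀ {D} xs → D ∈ xs → OneOf xs D
∈⇒OneOf (x ∷ []) (here D≡x) = D≡x
∈⇒OneOf (x ∷ y ∷ xs) (here D≡x) = inj₁ D≡x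
∈⇒OneOf (x ∷ y ∷ xs) (there D∈xs) = inj₂ (∈⇒OneOf (y ∷ xs) D∈xs)

OneOf⇒∈ : ∀ {D} xs → OneOf xs D → D ∈ xs
OneOf⇒∈ (x ∷ []) D≡x = here D≡x
OneOf⇒∈ (x ∷ y ∷ xs) (inj₁ D≡x) = here D≡x
OneOf⇒∈ (x ∷ y ∷ xs) (inj₂ D∈xs) = there (OneOf⇒∈ (y ∷ xs) D∈xs)

rationalCountsᵇ : ℕ → ℕ → Bool
rationalCountsᵇ m n = distinctᵇ (rationalPartitions n) ∧ (m ℕ.≡ᵇ length (rationalPartitions n))

Refuted : ℕ → List ℕ → (ℕ → Elt) → ℕ → Set
Refuted m exceptions witness D =
  D ℕ.< 2 ⊎ HasSquareFactor D ⊎ D ∈ exceptions ⊎ T (countsᵇ D m (witness D))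

refuted? : ∀ m exceptions witness D → Dec (Refuted m exceptions witness D)
refuted? m exceptions witness D =
  D ℕ.<? 2 ⊎-dec hasSquareFactor? D ⊎-dec DecMembership._∈?_ ℕ._≟_ D exceptions ⊎-dec T? (countsᵇ D m (witness D))

-- With n = suc p: for D ≥ n² the rational integer n is a witness as soon as its classical
-- partition count is m; each D < n² is checked individually.
Classification : ℕ → ℕ → List ℕ → (ℕ → Elt) → Set
Classification m p exceptions witness =
  T (rationalCountsᵇ m (suc p)) × All (Refuted m exceptions witness) (upTo (suc p ℕ.* suc p))

classification? : ∀ m p exceptions witness → Dec (Classification m p exceptions witness)
classification? m p exceptions witness =
  T? (rationalCountsᵇ m (suc p)) ×-dec All.all? (refuted? m exceptions witness) (upTo (suc p ℕ.* suc p))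

classified-⊆ : ∀ m p exceptions witness → Classification m p exceptions witness →
  ∀ D → Admissible D → InDset m D → D ∈ exceptions
classified-⊆ m p exceptions witness (rational-count , small-D) D (2≤D , D-squarefree) D∈𝒟
  with D ℕ.<? suc p ℕ.* suc p
... | no D≮n² with Equivalence.to T-∧ rational-count
...   | distinct , m≡ = ⊥-elim (D∈𝒟 (fromℕ (suc p) , fromℕ-totPos D p ,
          subst (PartitionCount D (fromℕ (suc p))) (sym (ℕP.≡ᵇ⇒≡ m _ m≡)) (partitionCount-fromℕ D p (ℕP.≮⇒≥ D≮n²) distinct)))
classified-⊆ m p exceptions witness (_ , small-D) D (2≤D , D-squarefree) D∈𝒟 | yes D<n²
  with All.lookup small-D (∈-upTo⁺ D<n²)
... | inj₁ D<2 = ⊥-elim (ℕP.<⇒≱ D<2 2≤D)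
... | inj₂ (inj₁ d²∣D) = ⊥-elim (hasSquareFactor⇒¬squareFree d²∣D D-squarefree)
... | inj₂ (inj₂ (inj₁ D∈exceptions)) = D∈exceptions
... | inj₂ (inj₂ (inj₂ counts)) = ⊥-elim (D∈𝒟 (witness D , countsᵇ-sound D m (witness D) (ℕP.≤-trans (s≤s z≤n) 2≤D) counts))

𝒟-characterisation : ∀ m p exceptions witness → True (classification? m p exceptions witness) →
  All (InDset m) exceptions → ∀ D → Admissible D → InDset m D ⇔ OneOf exceptions D
𝒟-characterisation m p exceptions witness c exceptions-excluded D D-admissible = mk⇔
  (∈⇒OneOf exceptions ∘ classified-⊆ m p exceptions witness (toWitness c) D D-admissible)
  (All.lookup exceptions-excluded ∘ OneOf⇒∈ exceptions)

conjugatePairs : List (ℕ × ℕ) → List Elt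
conjugatePairs [] = []
conjugatePairs ((u , zero) ∷ ps) = (+ u , 0ℤ) ∷ conjugatePairs ps
conjugatePairs ((u , suc v) ∷ ps) = (+ u , + suc v) ∷ (+ u , -[1+ v ]) ∷ conjugatePairs ps

-- ε = 3 + 2√2
unit₂ : NormOneUnit 2
unit₂ = record { a = 4 ; b = + 4 ; norm≡4 = refl
  ; evenProduct = λ x _ → evenProduct-double 2 (+ 3) (+ 2) x
  ; evenProduct′ = λ x _ → evenProduct-double 2 (+ 3) -[1+ 1 ] x }

-- ε = 2 + √3
unit₃ : NormOneUnit 3
unit₃ = record { a = 2 ; b = + 2 ; norm≡4 = refl
  ; evenProduct = λ x _ → evenProduct-double 3 (+ 2) (+ 1) x
  ; evenProduct′ = λ x _ → evenProduct-double 3 (+ 2) -[1+ 0 ] x }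

-- ε = (3 + √5)/2
unit₅ : NormOneUnit 5
unit₅ = record { a = 1 ; b = + 1 ; norm≡4 = refl
  ; evenProduct = λ { (u , v) (4∣N , _) → evenProduct-sameParity 5 (+ 3) (+ 1) (+ 4) (+ 2) refl refl u v (sameParity 1 u v 4∣N) }
  ; evenProduct′ = λ { (u , v) (4∣N , _) → evenProduct-sameParity 5 (+ 3) -[1+ 0 ] -[1+ 0 ] (+ 1) refl refl u v (sameParity 1 u v 4∣N) } }

-- ε = 5 + 2√6
unit₆ : NormOneUnit 6
unit₆ = record { a = 8 ; b = + 4 ; norm≡4 = refl
  ; evenProduct = λ x _ → evenProduct-double 6 (+ 5) (+ 2) x
  ; evenProduct′ = λ x _ → evenProduct-double 6 (+ 5) -[1+ 1 ] x }

-- ε = 8 + 3√7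
unit₇ : NormOneUnit 7
unit₇ = record { a = 14 ; b = + 6 ; norm≡4 = refl
  ; evenProduct = λ x _ → evenProduct-double 7 (+ 8) (+ 3) x
  ; evenProduct′ = λ x _ → evenProduct-double 7 (+ 8) -[1+ 2 ] x }

-- ε = (11 + 3√13)/2
unit₁₃ : NormOneUnit 13
unit₁₃ = record { a = 9 ; b = + 3 ; norm≡4 = refl
  ; evenProduct = λ { (u , v) (4∣N , _) → evenProduct-sameParity 13 (+ 11) (+ 3) (+ 25) (+ 7) refl refl u v (sameParity 3 u v 4∣N) }
  ; evenProduct′ = λ { (u , v) (4∣N , _) → evenProduct-sameParity 13 (+ 11) -[1+ 2 ] -[1+ 13 ] (+ 4) refl refl u v (sameParity 3 u v 4∣N) } }

-- ε = (5 + √21)/2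
unit₂₁ : NormOneUnit 21
unit₂₁ = record { a = 3 ; b = + 1 ; norm≡4 = refl
  ; evenProduct = λ { (u , v) (4∣N , _) → evenProduct-sameParity 21 (+ 5) (+ 1) (+ 13) (+ 3) refl refl u v (sameParity 5 u v 4∣N) }
  ; evenProduct′ = λ { (u , v) (4∣N , _) → evenProduct-sameParity 21 (+ 5) -[1+ 0 ] -[1+ 7 ] (+ 2) refl refl u v (sameParity 5 u v 4∣N) } }

2∈𝒟₅ : InDset 5 2
2∈𝒟₅ = Reduction.excluded (s≤s z≤n) unit₂ 5 7 47 (conjugatePairs ((8 , 0) ∷ (10 , 2) ∷ (10 , 4) ∷ (12 , 6) ∷ [])) tt

3∈𝒟₅ : InDset 5 3
3∈𝒟₅ = Reduction.excluded (s≤s z≤n) unit₃ 5 7 33 (conjugatePairs ((8 , 0) ∷ (10 , 2) ∷ (12 , 4) ∷ [])) tt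

5∈𝒟₃ : InDset 3 5
5∈𝒟₃ = Reduction.excluded (s≤s z≤n) unit₅ 3 7 25 (conjugatePairs ((6 , 0) ∷ (7 , 1) ∷ [])) tt

5∈𝒟₅ : InDset 5 5
5∈𝒟₅ = Reduction.excluded (s≤s z≤n) unit₅ 5 7 25 (conjugatePairs ((8 , 0) ∷ (9 , 1) ∷ (10 , 2) ∷ [])) tt

2∈𝒟₇ : InDset 7 2
2∈𝒟₇ = Reduction.excluded (s≤s z≤n) unit₂ 7 7 47 (conjugatePairs ((10 , 0) ∷ (10 , 2) ∷ (12 , 4) ∷ (14 , 6) ∷ (16 , 8) ∷ [])) tt

5∈𝒟₇ : InDset 7 5
5∈𝒟₇ = Reduction.excluded (s≤s z≤n) unit₅ 7 7 25 (conjugatePairs ((8 , 0) ∷ (9 , 1) ∷ (10 , 2) ∷ [])) tt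

2∈𝒟₁₁ : InDset 11 2
2∈𝒟₁₁ = Reduction.excluded (s≤s z≤n) unit₂ 11 7 47 (conjugatePairs ((12 , 0) ∷ (12 , 2) ∷ (12 , 4) ∷ (14 , 6) ∷ (16 , 8) ∷ [])) tt

3∈𝒟₁₁ : InDset 11 3
3∈𝒟₁₁ = Reduction.excluded (s≤s z≤n) unit₃ 11 7 33 (conjugatePairs ((12 , 0) ∷ (12 , 2) ∷ (14 , 4) ∷ [])) tt

5∈𝒟₁₁ : InDset 11 5
5∈𝒟₁₁ = Reduction.excluded (s≤s z≤n) unit₅ 11 7 25 (conjugatePairs ((10 , 0) ∷ (11 , 1) ∷ (12 , 2) ∷ [])) tt

6∈𝒟₁₁ : InDset 11 6
6∈𝒟₁₁ = Reduction.excluded (s≤s z≤n) unit₆ 11 7 76 (conjugatePairs ((12 , 0) ∷ (14 , 2) ∷ (16 , 4) ∷ (20 , 6) ∷ (24 , 8) ∷ [])) tt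

7∈𝒟₁₁ : InDset 11 7
7∈𝒟₁₁ = Reduction.excluded (s≤s z≤n) unit₇ 11 7 118
  (conjugatePairs ((12 , 0) ∷ (14 , 2) ∷ (18 , 4) ∷ (22 , 6) ∷ (26 , 8) ∷ (30 , 10) ∷ [])) tt

13∈𝒟₁₁ : InDset 11 13
13∈𝒟₁₁ = Reduction.excluded (s≤s z≤n) unit₁₃ 11 7 83
  (conjugatePairs ((12 , 0) ∷ (13 , 1) ∷ (14 , 2) ∷ (17 , 3) ∷ (20 , 4) ∷ (23 , 5) ∷ (26 , 6) ∷ [])) tt

21∈𝒟₁₁ : InDset 11 21
21∈𝒟₁₁ = Reduction.excluded (s≤s z≤n) unit₂₁ 11 7 40 (conjugatePairs ((12 , 0) ∷ (13 , 1) ∷ (16 , 2) ∷ [])) tt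


witnessTable : Elt → List (ℕ × Elt) → ℕ → Elt
witnessTable default [] D = default
witnessTable default ((D′ , α) ∷ table) D = if D ℕ.≡ᵇ D′ then α else witnessTable default table D

witness₇ : ℕ → Elt
witness₇ = witnessTable (fromℕ 5) ((3 , (+ 10 , + 2)) ∷ (13 , (+ 11 , + 1)) ∷ (17 , (+ 11 , + 1)) ∷ (21 , (+ 11 , + 1)) ∷ [])

witness₁₁ : ℕ → Elt
witness₁₁ = witnessTable (fromℕ 6) ((17 , (+ 28 , + 6)) ∷ [])

theorem1p3 : (∀ D → Admissible D → (InDset 1 D ⇔ ⊥))
    × (∀ D → Admissible D → (InDset 2 D ⇔ ⊥))
    × (∀ D → Admissible D → (InDset 3 D ⇔ D ≡ 5))
    × (∀ D → Admissible D → (InDset 5 D ⇔ (D ≡ 2 ⊎ D ≡ 3 ⊎ D ≡ 5)))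
    × (∀ D → Admissible D → (InDset 7 D ⇔ (D ≡ 2 ⊎ D ≡ 5)))
    × (∀ D → Admissible D → (InDset 11 D ⇔ (D ≡ 2 ⊎ D ≡ 3 ⊎ D ≡ 5 ⊎ D ≡ 6 ⊎ D ≡ 7 ⊎ D ≡ 13 ⊎ D ≡ 21)))
theorem1p3 =
    𝒟-characterisation 1 0 [] (λ _ → fromℕ 1) tt []
  , 𝒟-characterisation 2 1 [] (λ _ → fromℕ 2) tt []
  , 𝒟-characterisation 3 2 (5 ∷ []) (λ _ → fromℕ 3) tt (5∈𝒟₃ ∷ [])
  , 𝒟-characterisation 5 3 (2 ∷ 3 ∷ 5 ∷ []) (λ _ → fromℕ 4) tt (2∈𝒟₅ ∷ 3∈𝒟₅ ∷ 5∈𝒟₅ ∷ [])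
  , 𝒟-characterisation 7 4 (2 ∷ 5 ∷ []) witness₇ tt (2∈𝒟₇ ∷ 5∈𝒟₇ ∷ [])
  , 𝒟-characterisation 11 5 (2 ∷ 3 ∷ 5 ∷ 6 ∷ 7 ∷ 13 ∷ 21 ∷ []) witness₁₁ tt
      (2∈𝒟₁₁ ∷ 3∈𝒟₁₁ ∷ 5∈𝒟₁₁ ∷ 6∈𝒟₁₁ ∷ 7∈𝒟₁₁ ∷ 13∈𝒟₁₁ ∷ 21∈𝒟₁₁ ∷ [])
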